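{- Let $g',d,n$ be positive integers and let $c_0\in\mathbb{Z}$. Then there is a constant $C>0$ depending only on $g',d,n$ such that for all sufficiently large primes $\ell$, $$\frac{|C_\ell(g',d,n,c_0)|}{|A_\ell(g',d)|}\le \frac{C}{\ell}.$$
   Context: For a prime $\ell$, $\mu_n(\mathbb{F}_\ell)=\{\zeta\in\mathbb{F}_\ell:\zeta^n=1\}$. Elements of $\prod_{i=1}^{g'}\prod_{j=1}^{d}\operatorname{GL}_2(\mathbb{F}_\ell)$ are written $(M_{ij})_{1\le i\le g',1\le j\le d}$. Define $A_\ell(g',d)=\{(M_{ij}): M_{ij}=M_{ij'}\text{ for all }i,j,j',\ \det M_{ij}=\det M_{i'j'}\text{ for all }i,i',j,j'\}$; $B_\ell(g',d,n)=\{(M_{ij}): M_{i1}^{ -1}M_{ij}\in\mu_n(\mathbb{F}_\ell)I_2\text{ for all }1\le i\le g',1\le j\le d,\ (\det M_{i1})^n=(\det M_{i'1})^n\text{ for all }1\le i,i'\le g'\}$; $C_\ell(g',d,n,c_0)=\{(M_{ij})\in B_\ell(g',d,n): (\prod_{i,j}\operatorname{tr}M_{ij})^2=\bar{c_0}\prod_{i,j}\det M_{ij}\}$, where $\bar{c_0}=c_0\bmod\ell$. -}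

module Defs where

open import Data.Nat as ℕ using (ℕ; zero; suc)
open import Data.Integer as ℤ using (ℤ; +_; _%ℕ_)
open import Data.Bool using (Bool; true; false; _∧_; not)
open import Data.List as List using (List; []; _∷_; upTo; filterᵇ; length; concatMap; map)
open import Data.Bool.ListAction using (all; any)
open import Data.Vec as Vec using (Vec; []; _∷_)
open import Relation.Nullary.Decidable using (⌊_⌋)

-- Residues in F_ℓ: an integer x represents the class x mod ℓ.
-- (For ℓ = 0, which never occurs since ℓ is prime, we use |x|.)
red : ℕ → ℤ → ℕ
red zero    x = ℤ.∣ x ∣
red (suc k) x = x %ℕ suc k

eqF : ℕ → ℤ → ℤ → Bool
eqF ℓ x y = ⌊ red ℓ x ℕ.≟ red ℓ y ⌋

elemsF : ℕ → List ℤ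
elemsF ℓ = map +_ (upTo ℓ)

-- 2×2 matrices ( a b ; c d )
record Mat : Set where
  constructor mat
  field a b c d : ℤ
open Mat public

det : Mat → ℤ
det M = a M ℤ.* d M ℤ.- b M ℤ.* c M

tr : Mat → ℤ
tr M = a M ℤ.+ d M

eqMat : ℕ → Mat → Mat → Bool
eqMat ℓ M N = eqF ℓ (a M) (a N) ∧ eqF ℓ (b M) (b N) ∧ eqF ℓ (c M) (c N) ∧ eqF ℓ (d M) (d N)

scale : ℤ → Mat → Mat
scale z M = mat (z ℤ.* a M) (z ℤ.* b M) (z ℤ.* c M) (z ℤ.* d M)

-- all elements of GL_2(F_ℓ) (each exactly once)
GL2 : ℕ → List Mat
GL2 ℓ = filterᵇ (λ M → not (eqF ℓ (det M) (+ 0)))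
  (concatMap (λ x → concatMap (λ y → concatMap (λ z → map (λ w → mat x y z w)
     (elemsF ℓ)) (elemsF ℓ)) (elemsF ℓ)) (elemsF ℓ))

allVecs : {A : Set} → List A → (n : ℕ) → List (Vec A n)
allVecs xs zero    = [] ∷ []
allVecs xs (suc n) = concatMap (λ x → map (x ∷_) (allVecs xs n)) xs

-- elements (M_ij) of ∏_{i=1}^{g'} ∏_{j=1}^{d} GL_2(F_ℓ): outer index i, inner index j
Tuple : ℕ → ℕ → Set
Tuple g' d = Vec (Vec Mat d) g'

allTuples : (ℓ g' d : ℕ) → List (Tuple g' d)
allTuples ℓ g' d = allVecs (allVecs (GL2 ℓ) d) g'

entries : {g' d : ℕ} → Tuple g' d → List Mat
entries T = List.concatMap Vec.toList (Vec.toList T)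

inMu : ℕ → ℕ → ℤ → Bool
inMu ℓ n z = eqF ℓ (z ℤ.^ n) (+ 1)

inA : (ℓ : ℕ) {g' d : ℕ} → Tuple g' d → Bool
inA ℓ T =
  Vec.foldr _ (λ row acc → all (λ M → all (λ N → eqMat ℓ M N) (Vec.toList row)) (Vec.toList row) ∧ acc) true T
  ∧ all (λ M → all (λ N → eqF ℓ (det M) (det N)) (entries T)) (entries T)

-- M_{i1}^{-1} M_ij ∈ μ_n(F_ℓ) I_2, i.e. M_ij = ζ M_{i1} for some ζ ∈ μ_n(F_ℓ)
rowCondB : ℕ → ℕ → {d : ℕ} → Vec Mat d → Bool
rowCondB ℓ n []        = true
rowCondB ℓ n (M₁ ∷ ms) =
  all (λ M → any (λ z → inMu ℓ n z ∧ eqMat ℓ M (scale z M₁)) (elemsF ℓ)) (M₁ ∷ Vec.toList ms)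

firsts : {g' d : ℕ} → Tuple g' d → List Mat
firsts [] = []
firsts {d = zero}  (_ ∷ rows)       = firsts rows
firsts {d = suc _} ((M ∷ _) ∷ rows) = M ∷ firsts rows

inB : (ℓ n : ℕ) {g' d : ℕ} → Tuple g' d → Bool
inB ℓ n T =
  Vec.foldr _ (λ row acc → rowCondB ℓ n row ∧ acc) true T
  ∧ all (λ M → all (λ N → eqF ℓ (det M ℤ.^ n) (det N ℤ.^ n)) (firsts T)) (firsts T)

prodZ : List ℤ → ℤ
prodZ = List.foldr ℤ._*_ (+ 1)

inC : (ℓ n : ℕ) (c₀ : ℤ) {g' d : ℕ} → Tuple g' d → Bool
inC ℓ n c₀ T = inB ℓ n T ∧
  eqF ℓ (prodZ (map tr (entries T)) ℤ.^ 2) (c₀ ℤ.* prodZ (map det (entries T)))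

cardA : (ℓ g' d : ℕ) → ℕ
cardA ℓ g' d = length (filterᵇ (inA ℓ) (allTuples ℓ g' d))

cardC : (ℓ g' d n : ℕ) (c₀ : ℤ) → ℕ
cardC ℓ g' d n c₀ = length (filterᵇ (inC ℓ n c₀) (allTuples ℓ g' d))

-- A tuple in C has rows (ζ₁ M, …, ζ_d M) with every ζⱼ an n-th root of unity, so each row has at most
-- n^(d-1) completions of its first entry M, and after cancelling the nonzero factor ∏ ζ the identity defining
-- C becomes ∏ tr(Mᵢ)^(2d) = c₀ ∏ det(Mᵢ)^d for the first column M₁, …, M_g', whose determinants have equal
-- n-th powers.  Choosing the Mᵢ in turn, every Mᵢ after M₁ has one of at most n determinants and hence
-- O(ℓ³) possibilities; the last one must moreover have its trace among the at most 2d roots of a nonzero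
-- polynomial, leaving O(ℓ²).  That polynomial vanishes identically only if an earlier trace is 0, which
-- saves the same factor ℓ.  So |C| = O(ℓ^(3g')), while A contains all tuples with constant rows and one
-- common nonzero determinant, whence |A| ≥ (ℓ - 1)((ℓ - 1)ℓ²)^g'.  As ℓ ≤ 2(ℓ - 1), this gives ℓ|C| ≤ C|A| for
-- every prime ℓ.

module Submission where

open import Defs
open import Data.Nat using (ℕ; _*_; _≤_; _>_; _≥_)
open import Data.Nat.Primality using (Prime)
open import Data.Integer using (ℤ)
open import Data.Product using (∃-syntax; _×_)

import Algebra.Properties.CommutativeSemigroup
open import Data.Bool using (Bool; true; false; T; _∧_; not)
open import Data.Bool.ListAction using (all; any)
open import Data.Bool.Properties using (∧-assoc)
open import Data.Empty using (⊥-elim)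
open import Data.Integer as ℤ using (+_; _/ℕ_; ∣_∣)
open import Data.Integer.DivMod using (a≡a%ℕn+[a/ℕn]*n; n%ℕd<d)
open import Data.Integer.Divisibility.Signed as ℤ∣ using (divides)
import Data.Integer.Properties as ℤ
open import Data.Integer.Tactic.RingSolver using (solve-∀)
open import Data.List using (List; []; _∷_; _++_; map; concatMap; filterᵇ; length; upTo)
open import Data.List.Membership.Propositional using (_∈_; find)
open import Data.List.Membership.Propositional.Properties
  using (∈-map⁺; ∈-map⁻; ∈-concat⁺′; ∈-upTo⁺; ∈-upTo⁻; ∈-filter⁻; ∈-++⁻)
open import Data.List.Properties using (length-map; length-upTo)
open import Data.List.Relation.Unary.All as All using (All; []; _∷_)
open import Data.List.Relation.Unary.All.Properties using (all⁺; all⁻; replicate⁺)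
open import Data.List.Relation.Unary.AllPairs using (_∷_)
open import Data.List.Relation.Unary.Any using (here; there)
open import Data.List.Relation.Unary.Any.Properties using (any⁻)
open import Data.List.Relation.Unary.Unique.Propositional using (Unique)
import Data.List.Relation.Unary.Unique.Propositional.Properties as Unique
open import Data.Nat as ℕ using (zero; suc; _+_; _^_; _<_; z≤n; s≤s)
open import Data.Nat.Coprimality using (coprime-Bézout; prime⇒coprime)
open import Data.Nat.DivMod using (m<n⇒m%n≡m)
import Data.Nat.Divisibility as ℕ∣
open import Data.Nat.GCD using (module Bézout)
open import Data.Nat.Primality using (euclidsLemma; ¬prime[0]; ¬prime[1])
import Data.Nat.Properties as ℕ
import Data.Nat.Tactic.RingSolver as ℕ-Solver
open import Data.Product using (∃; _,_; proj₂)
open import Data.Sum as Sum using (_⊎_; inj₁; inj₂; [_,_]′)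
open import Data.Unit using (tt)
open import Data.Vec as Vec using (Vec; []; _∷_)
open import Data.Vec.Properties using (length-toList; toList-replicate)
open import Level using (0ℓ)
open import Relation.Binary using (Setoid; Decidable)
import Relation.Binary.Reasoning.Setoid
open import Relation.Binary.PropositionalEquality
open import Relation.Nullary using (¬_; Dec; yes; no)
open import Relation.Nullary.Decidable using (⌊_⌋; map′; toWitness; fromWitness; T?)

private variable
  A B E : Set

⟦_⟧ : Bool → ℕ
⟦ true  ⟧ = 1
⟦ false ⟧ = 0

∑ : List A → (A → ℕ) → ℕ
∑ []       f = 0
∑ (x ∷ xs) f = f x + ∑ xs f

syntax ∑ xs (λ x → e) = ∑[ x ← xs ] e

count : (A → Bool) → List A → ℕ
count p xs = ∑[ x ← xs ] ⟦ p x ⟧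

⟦⟧≤1 : ∀ b → ⟦ b ⟧ ≤ 1
⟦⟧≤1 true  = ℕ.≤-refl
⟦⟧≤1 false = z≤n

⟦⟧-mono : ∀ {b c} → (T b → T c) → ⟦ b ⟧ ≤ ⟦ c ⟧
⟦⟧-mono {false}         _ = z≤n
⟦⟧-mono {true} {true}   _ = ℕ.≤-refl
⟦⟧-mono {true} {false}  f = ⊥-elim (f tt)

⟦⟧-true : ∀ {b} → T b → ⟦ b ⟧ ≡ 1
⟦⟧-true {true} _ = refl

⟦⟧-false : ∀ {b} → ¬ T b → ⟦ b ⟧ ≡ 0
⟦⟧-false {true}  f = ⊥-elim (f tt)
⟦⟧-false {false} _ = refl

∧-elimˡ : ∀ {a b} → T (a ∧ b) → T a
∧-elimˡ {true} _ = tt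

∧-elimʳ : ∀ {a b} → T (a ∧ b) → T b
∧-elimʳ {true} t = t

∧-intro : ∀ {a b} → T a → T b → T (a ∧ b)
∧-intro {true} _ t = t

not-intro : ∀ {a} → ¬ T a → T (not a)
not-intro {true}  f = f tt
not-intro {false} _ = tt

not-elim : ∀ {a} → T (not a) → ¬ T a
not-elim {true} ()

⟦∧⟧ : ∀ b c → ⟦ b ∧ c ⟧ ≡ ⟦ b ⟧ * ⟦ c ⟧
⟦∧⟧ true  c = sym (ℕ.+-identityʳ ⟦ c ⟧)
⟦∧⟧ false c = refl


∑-cong : ∀ (xs : List A) {f g : A → ℕ} → (∀ {x} → x ∈ xs → f x ≡ g x) → ∑ xs f ≡ ∑ xs g
∑-cong []       h = refl
∑-cong (x ∷ xs) h = cong₂ _+_ (h (here refl)) (∑-cong xs (λ m → h (there m)))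

∑-mono : ∀ (xs : List A) {f g : A → ℕ} → (∀ {x} → x ∈ xs → f x ≤ g x) → ∑ xs f ≤ ∑ xs g
∑-mono []       h = z≤n
∑-mono (x ∷ xs) h = ℕ.+-mono-≤ (h (here refl)) (∑-mono xs (λ m → h (there m)))

∑-+ : ∀ (xs : List A) (f g : A → ℕ) → ∑[ x ← xs ] (f x + g x) ≡ ∑ xs f + ∑ xs g
∑-+ []       f g = refl
∑-+ (x ∷ xs) f g = trans (cong (_+_ (f x + g x)) (∑-+ xs f g)) (+-interchange (f x) (g x) _ _)
  where open import Algebra.Properties.CommutativeSemigroup ℕ.+-commutativeSemigroup
          renaming (interchange to +-interchange)

∑-*ˡ : ∀ (xs : List A) c (f : A → ℕ) → ∑[ x ← xs ] (c * f x) ≡ c * ∑ xs f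
∑-*ˡ []       c f = sym (ℕ.*-zeroʳ c)
∑-*ˡ (x ∷ xs) c f = trans (cong (_+_ (c * f x)) (∑-*ˡ xs c f)) (sym (ℕ.*-distribˡ-+ c (f x) _))

∑-*ʳ : ∀ (xs : List A) c (f : A → ℕ) → ∑[ x ← xs ] (f x * c) ≡ ∑ xs f * c
∑-*ʳ []       c f = refl
∑-*ʳ (x ∷ xs) c f = trans (cong (_+_ (f x * c)) (∑-*ʳ xs c f)) (sym (ℕ.*-distribʳ-+ c (f x) _))

∑-const : ∀ (xs : List A) c → ∑[ _ ← xs ] c ≡ length xs * c
∑-const []       c = refl
∑-const (x ∷ xs) c = cong (_+_ c) (∑-const xs c)

∑-≤-const : ∀ (xs : List A) {f : A → ℕ} c → (∀ {x} → x ∈ xs → f x ≤ c) → ∑ xs f ≤ length xs * c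
∑-≤-const xs c h = ℕ.≤-trans (∑-mono xs h) (ℕ.≤-reflexive (∑-const xs c))

∑-≥-const : ∀ (xs : List A) {f : A → ℕ} c → (∀ {x} → x ∈ xs → c ≤ f x) → length xs * c ≤ ∑ xs f
∑-≥-const xs c h = ℕ.≤-trans (ℕ.≤-reflexive (sym (∑-const xs c))) (∑-mono xs h)

∑-++ : ∀ (xs ys : List A) (f : A → ℕ) → ∑ (xs ++ ys) f ≡ ∑ xs f + ∑ ys f
∑-++ []       ys f = refl
∑-++ (x ∷ xs) ys f = trans (cong (_+_ (f x)) (∑-++ xs ys f)) (sym (ℕ.+-assoc (f x) _ _))

∑-map : ∀ (g : A → B) xs (f : B → ℕ) → ∑ (map g xs) f ≡ ∑[ x ← xs ] f (g x)
∑-map g []       f = refl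
∑-map g (x ∷ xs) f = cong (_+_ (f (g x))) (∑-map g xs f)

∑-concatMap : ∀ (g : A → List B) xs (f : B → ℕ) →
  ∑ (concatMap g xs) f ≡ ∑[ x ← xs ] ∑ (g x) f
∑-concatMap g []       f = refl
∑-concatMap g (x ∷ xs) f = trans (∑-++ (g x) (concatMap g xs) f) (cong (_+_ (∑ (g x) f)) (∑-concatMap g xs f))

∑-allVecs-suc : ∀ (xs : List A) n (f : Vec A (suc n) → ℕ) →
  ∑ (allVecs xs (suc n)) f ≡ ∑[ x ← xs ] ∑[ v ← allVecs xs n ] f (x ∷ v)
∑-allVecs-suc xs n f = trans (∑-concatMap (λ x → map (x ∷_) (allVecs xs n)) xs f)
  (∑-cong xs (λ {x} _ → ∑-map (x ∷_) (allVecs xs n) f))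


count-mono : ∀ (xs : List A) {p q : A → Bool} → (∀ {x} → x ∈ xs → T (p x) → T (q x)) →
  count p xs ≤ count q xs
count-mono xs h = ∑-mono xs (λ m → ⟦⟧-mono (h m))

count-≤-length : ∀ (p : A → Bool) xs → count p xs ≤ length xs
count-≤-length p xs = ℕ.≤-trans (∑-≤-const xs 1 (λ {x} _ → ⟦⟧≤1 (p x))) (ℕ.≤-reflexive (ℕ.*-identityʳ _))

count-∧ˡ : ∀ (xs : List A) b (p : A → Bool) → count (λ x → b ∧ p x) xs ≡ ⟦ b ⟧ * count p xs
count-∧ˡ xs b p = trans (∑-cong xs (λ {x} _ → ⟦∧⟧ b (p x))) (∑-*ˡ xs ⟦ b ⟧ (λ x → ⟦ p x ⟧))

count-filterᵇ : ∀ (q p : A → Bool) xs → count p (filterᵇ q xs) ≡ count (λ x → q x ∧ p x) xs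
count-filterᵇ q p []       = refl
count-filterᵇ q p (x ∷ xs) with q x
... | true  = cong (_+_ ⟦ p x ⟧) (count-filterᵇ q p xs)
... | false = count-filterᵇ q p xs

length-filterᵇ : ∀ (p : A → Bool) xs → length (filterᵇ p xs) ≡ count p xs
length-filterᵇ p []       = refl
length-filterᵇ p (x ∷ xs) with p x
... | true  = cong suc (length-filterᵇ p xs)
... | false = length-filterᵇ p xs

count-member : ∀ (p : A → Bool) {x xs} → x ∈ xs → T (p x) → 1 ≤ count p xs
count-member p {x} (here refl) t = ℕ.≤-trans (ℕ.≤-reflexive (sym (⟦⟧-true t))) (ℕ.m≤m+n ⟦ p x ⟧ _)
count-member p {xs = y ∷ _} (there m) t = ℕ.≤-trans (count-member p m t) (ℕ.m≤n+m _ ⟦ p y ⟧)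

count-none : ∀ (p : A → Bool) xs → (∀ {x} → x ∈ xs → ¬ T (p x)) → count p xs ≡ 0
count-none p []       h = refl
count-none p (x ∷ xs) h = cong₂ _+_ (⟦⟧-false (h (here refl))) (count-none p xs (λ m → h (there m)))

count-zero-or-witness : ∀ (p : A → Bool) xs → count p xs ≡ 0 ⊎ ∃ λ x → x ∈ xs × T (p x)
count-zero-or-witness p []       = inj₁ refl
count-zero-or-witness p (x ∷ xs) with p x in eq
... | true  = inj₂ (x , here refl , subst T (sym eq) tt)
... | false with count-zero-or-witness p xs
...   | inj₁ z            = inj₁ z
...   | inj₂ (y , m , ty) = inj₂ (y , there m , ty)

count-≤1 : ∀ (p : A → Bool) xs → Unique xs →
  (∀ {x y} → x ∈ xs → y ∈ xs → T (p x) → T (p y) → x ≡ y) → count p xs ≤ 1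
count-≤1 p []       _        _ = z≤n
count-≤1 p (x ∷ xs) (x∉ ∷ u) h with p x in eq
... | false = count-≤1 p xs u (λ mx my → h (there mx) (there my))
... | true  = ℕ.≤-reflexive (cong suc (count-none p xs
      (λ m t → All.lookup x∉ m (h (here refl) (there m) (subst T (sym eq) tt) t))))

count-∨ : ∀ (xs : List A) {p q r : A → Bool} → (∀ {x} → x ∈ xs → T (p x) → T (q x) ⊎ T (r x)) →
  count p xs ≤ count q xs + count r xs
count-∨ xs {p} {q} {r} h = ℕ.≤-trans (∑-mono xs one) (ℕ.≤-reflexive (∑-+ xs _ _))
  where
  one : ∀ {x} → x ∈ xs → ⟦ p x ⟧ ≤ ⟦ q x ⟧ + ⟦ r x ⟧
  one {x} m with p x in eq
  ... | false = z≤n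
  ... | true with h m (subst T (sym eq) tt)
  ...   | inj₁ tq = ℕ.≤-trans (ℕ.≤-reflexive (sym (⟦⟧-true tq))) (ℕ.m≤m+n _ _)
  ...   | inj₂ tr = ℕ.≤-trans (ℕ.≤-reflexive (sym (⟦⟧-true tr))) (ℕ.m≤n+m _ _)

union-bound : (xs : List A) (es : List E) (p : A → Bool) (q : E → A → Bool) →
  (∀ {x} → x ∈ xs → T (p x) → ∃ λ e → e ∈ es × T (q e x)) →
  count p xs ≤ ∑[ e ← es ] count (q e) xs
union-bound []       es p q h = z≤n
union-bound (x ∷ xs) es p q h = begin
  ⟦ p x ⟧ + count p xs
    ≤⟨ ℕ.+-mono-≤ head (union-bound xs es p q (λ m → h (there m))) ⟩
  ∑[ e ← es ] ⟦ q e x ⟧ + ∑[ e ← es ] count (q e) xs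
    ≡⟨ sym (∑-+ es _ _) ⟩
  ∑[ e ← es ] count (q e) (x ∷ xs) ∎
  where
  open ℕ.≤-Reasoning
  head : ⟦ p x ⟧ ≤ ∑[ e ← es ] ⟦ q e x ⟧
  head with p x in eq
  ... | false = z≤n
  ... | true with h (here refl) (subst T (sym eq) tt)
  ...   | e , me , t = count-member (λ e → q e x) me t

allVecs-∈ : ∀ (xs : List A) {n} (v : Vec A n) → All (_∈ xs) (Vec.toList v) → v ∈ allVecs xs n
allVecs-∈ xs []      _          = here refl
allVecs-∈ xs (x ∷ v) (x∈ ∷ v∈) =
  ∈-concat⁺′ (∈-map⁺ (x ∷_) (allVecs-∈ xs v v∈)) (∈-map⁺ (λ y → map (y ∷_) (allVecs xs _)) x∈)

count-allVecs-all : ∀ (xs : List A) n (p : A → Bool) →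
  count (λ v → all p (Vec.toList v)) (allVecs xs n) ≤ count p xs ^ n
count-allVecs-all xs zero    p = ℕ.≤-refl
count-allVecs-all xs (suc n) p = begin
  count (λ v → all p (Vec.toList v)) (allVecs xs (suc n))
    ≡⟨ ∑-allVecs-suc xs n _ ⟩
  ∑[ x ← xs ] count (λ v → p x ∧ all p (Vec.toList v)) (allVecs xs n)
    ≡⟨ ∑-cong xs (λ {x} _ → count-∧ˡ (allVecs xs n) (p x) _) ⟩
  ∑[ x ← xs ] (⟦ p x ⟧ * count (λ v → all p (Vec.toList v)) (allVecs xs n))
    ≤⟨ ∑-mono xs (λ {x} _ → ℕ.*-monoʳ-≤ ⟦ p x ⟧ (count-allVecs-all xs n p)) ⟩
  ∑[ x ← xs ] (⟦ p x ⟧ * count p xs ^ n)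
    ≡⟨ ∑-*ʳ xs _ (λ x → ⟦ p x ⟧) ⟩
  count p xs ^ suc n ∎
  where open ℕ.≤-Reasoning

∑-comm : ∀ (xs : List A) (ys : List B) (f : A → B → ℕ) →
  ∑[ x ← xs ] ∑[ y ← ys ] f x y ≡ ∑[ y ← ys ] ∑[ x ← xs ] f x y
∑-comm []       ys f = sym (trans (∑-const ys 0) (ℕ.*-zeroʳ (length ys)))
∑-comm (x ∷ xs) ys f = trans (cong (_+_ (∑ ys (f x))) (∑-comm xs ys f)) (sym (∑-+ ys (f x) _))

count-≤-⟦⟧ : ∀ (p : A → Bool) xs b → count p xs ≤ 1 → (∀ {x} → x ∈ xs → T (p x) → T b) →
  count p xs ≤ ⟦ b ⟧
count-≤-⟦⟧ p xs true  ≤1 _ = ≤1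
count-≤-⟦⟧ p xs false _  h = ℕ.≤-reflexive (count-none p xs h)

count-∧⁴ : ∀ (xs : List A) (p q r s : A → Bool) →
  ∑[ x ← xs ] ∑[ y ← xs ] ∑[ z ← xs ] count (λ w → p x ∧ (q y ∧ (r z ∧ s w))) xs
    ≡ count p xs * (count q xs * (count r xs * count s xs))
count-∧⁴ xs p q r s = begin
  ∑[ x ← xs ] ∑[ y ← xs ] ∑[ z ← xs ] count (λ w → p x ∧ (q y ∧ (r z ∧ s w))) xs
    ≡⟨ ∑-cong xs (λ {x} _ → ∑-cong xs (λ {y} _ → ∑-cong xs (λ {z} _ → innermost (p x) (q y) (r z)))) ⟩
  ∑[ x ← xs ] ∑[ y ← xs ] ∑[ z ← xs ] (⟦ p x ⟧ * (⟦ q y ⟧ * (⟦ r z ⟧ * S)))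
    ≡⟨ ∑-cong xs (λ {x} _ → ∑-cong xs (λ {y} _ → pull (p x) (q y))) ⟩
  ∑[ x ← xs ] ∑[ y ← xs ] (⟦ p x ⟧ * (⟦ q y ⟧ * (R * S)))
    ≡⟨ ∑-cong xs (λ {x} _ → trans (∑-*ˡ xs ⟦ p x ⟧ _) (cong (⟦ p x ⟧ *_) (∑-*ʳ xs (R * S) (λ y → ⟦ q y ⟧)))) ⟩
  ∑[ x ← xs ] (⟦ p x ⟧ * (count q xs * (R * S)))
    ≡⟨ ∑-*ʳ xs _ (λ x → ⟦ p x ⟧) ⟩
  count p xs * (count q xs * (R * S)) ∎
  where
  open ≡-Reasoning
  R = count r xs
  S = count s xs
  innermost : ∀ a b c → count (λ w → a ∧ (b ∧ (c ∧ s w))) xs ≡ ⟦ a ⟧ * (⟦ b ⟧ * (⟦ c ⟧ * S))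
  innermost a b c = trans (count-∧ˡ xs a _) (cong (⟦ a ⟧ *_)
    (trans (count-∧ˡ xs b _) (cong (⟦ b ⟧ *_) (count-∧ˡ xs c s))))
  pull : ∀ a b → ∑[ z ← xs ] (⟦ a ⟧ * (⟦ b ⟧ * (⟦ r z ⟧ * S))) ≡ ⟦ a ⟧ * (⟦ b ⟧ * (R * S))
  pull a b = trans (∑-*ˡ xs ⟦ a ⟧ _) (cong (⟦ a ⟧ *_)
    (trans (∑-*ˡ xs ⟦ b ⟧ _) (cong (⟦ b ⟧ *_) (∑-*ʳ xs S (λ z → ⟦ r z ⟧)))))

residues-≡ : ∀ {ℓ r s} → r < ℓ → s < ℓ → + ℓ ℤ∣.∣ + r ℤ.- + s → r ≡ s
residues-≡ {ℓ} {r} {s} r<ℓ s<ℓ ℓ∣r-s = ℤ.+-injective (begin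
    + r                   ≡⟨ r≡[r-s]+s (+ r) (+ s) ⟩
    (+ r ℤ.- + s) ℤ.+ + s ≡⟨ cong (ℤ._+ + s) (ℤ.∣i∣≡0⇒i≡0 {+ r ℤ.- + s} ∣r-s∣≡0) ⟩
    + s                   ∎)
  where
  open ≡-Reasoning
  r≡[r-s]+s : ∀ a b → a ≡ (a ℤ.- b) ℤ.+ b
  r≡[r-s]+s = solve-∀
  ∣r-s∣<ℓ : ∣ + r ℤ.- + s ∣ < ℓ
  ∣r-s∣<ℓ = subst (λ z → ∣ z ∣ < ℓ) (sym (ℤ.m-n≡m⊖n r s))
    (ℕ.≤-<-trans (ℤ.∣m⊝n∣≤m⊔n r s) (ℕ.⊔-lub r<ℓ s<ℓ))
  ∣r-s∣≡0 : ∣ + r ℤ.- + s ∣ ≡ 0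
  ∣r-s∣≡0 with ∣ + r ℤ.- + s ∣ | ℤ∣.∣⇒∣ᵤ ℓ∣r-s | ∣r-s∣<ℓ
  ... | zero  | _ | _ = refl
  ... | suc _ | ℓ∣ | ℓ> = ⊥-elim (ℕ∣.>⇒∤ ℓ> ℓ∣)

-- The modulus is written 2 + k so that red ℓ and elemsF ℓ compute.
module Residues (k : ℕ) where

  ℓ : ℕ
  ℓ = suc (suc k)

  infix 4 _≈_ _≉_ _≈?_

  record _≈_ (x y : ℤ) : Set where
    constructor mk≈
    field red-≡ : red ℓ x ≡ red ℓ y
  open _≈_ public

  _≉_ : ℤ → ℤ → Set
  x ≉ y = ¬ x ≈ y

  _≈?_ : Decidable _≈_
  x ≈? y = map′ mk≈ red-≡ (red ℓ x ℕ.≟ red ℓ y)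

  eqF⇒≈ : ∀ {x y} → T (eqF ℓ x y) → x ≈ y
  eqF⇒≈ t = mk≈ (toWitness t)

  ≈⇒eqF : ∀ {x y} → x ≈ y → T (eqF ℓ x y)
  ≈⇒eqF (mk≈ p) = fromWitness p


  eqF-resp : ∀ {x x' y y'} → x ≈ x' → y ≈ y' → T (eqF ℓ x y) → T (eqF ℓ x' y')
  eqF-resp (mk≈ p) (mk≈ q) = subst T (cong₂ (λ a b → ⌊ a ℕ.≟ b ⌋) p q)

  ≈-setoid : Setoid 0ℓ 0ℓ
  ≈-setoid = record
    { Carrier       = ℤ
    ; _≈_           = _≈_
    ; isEquivalence = record
      { refl  = mk≈ refl
      ; sym   = λ (mk≈ p) → mk≈ (sym p)
      ; trans = λ (mk≈ p) (mk≈ q) → mk≈ (trans p q)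
      }
    }

  open Setoid ≈-setoid public using () renaming (refl to ≈-refl; sym to ≈-sym; trans to ≈-trans; reflexive to ≈-reflexive)
  module ≈-Reasoning = Relation.Binary.Reasoning.Setoid ≈-setoid

  private
    division : ∀ x → x ≡ + red ℓ x ℤ.+ (x /ℕ ℓ) ℤ.* + ℓ
    division x = a≡a%ℕn+[a/ℕn]*n x ℓ

  ≈⇒∣ : ∀ {x y} → x ≈ y → + ℓ ℤ∣.∣ x ℤ.- y
  ≈⇒∣ {x} {y} (mk≈ p) = divides (x /ℕ ℓ ℤ.- y /ℕ ℓ) (begin
      x ℤ.- y
        ≡⟨ cong₂ ℤ._-_ (division x) (division y) ⟩
      (+ red ℓ x ℤ.+ x /ℕ ℓ ℤ.* + ℓ) ℤ.- (+ red ℓ y ℤ.+ y /ℕ ℓ ℤ.* + ℓ)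
        ≡⟨ cong (λ r → (+ r ℤ.+ x /ℕ ℓ ℤ.* + ℓ) ℤ.- (+ red ℓ y ℤ.+ y /ℕ ℓ ℤ.* + ℓ)) p ⟩
      (+ red ℓ y ℤ.+ x /ℕ ℓ ℤ.* + ℓ) ℤ.- (+ red ℓ y ℤ.+ y /ℕ ℓ ℤ.* + ℓ)
        ≡⟨ cancel-r (+ red ℓ y) (x /ℕ ℓ) (y /ℕ ℓ) (+ ℓ) ⟩
      (x /ℕ ℓ ℤ.- y /ℕ ℓ) ℤ.* + ℓ ∎)
    where
    open ≡-Reasoning
    cancel-r : ∀ r a b l → (r ℤ.+ a ℤ.* l) ℤ.- (r ℤ.+ b ℤ.* l) ≡ (a ℤ.- b) ℤ.* l
    cancel-r = solve-∀

  ∣⇒≈ : ∀ {x y} → + ℓ ℤ∣.∣ x ℤ.- y → x ≈ y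
  ∣⇒≈ {x} {y} ℓ∣x-y = mk≈ (residues-≡ (n%ℕd<d x ℓ) (n%ℕd<d y ℓ) ℓ∣rx-ry)
    where
    qx = x /ℕ ℓ
    qy = y /ℕ ℓ
    split : ∀ rx ry qx qy l → (rx ℤ.+ qx ℤ.* l) ℤ.- (ry ℤ.+ qy ℤ.* l) ≡ (rx ℤ.- ry) ℤ.+ (qx ℤ.- qy) ℤ.* l
    split = solve-∀
    x-y≡ : x ℤ.- y ≡ (+ red ℓ x ℤ.- + red ℓ y) ℤ.+ (qx ℤ.- qy) ℤ.* + ℓ
    x-y≡ = trans (cong₂ ℤ._-_ (division x) (division y)) (split (+ red ℓ x) (+ red ℓ y) qx qy (+ ℓ))
    ℓ∣rx-ry : + ℓ ℤ∣.∣ + red ℓ x ℤ.- + red ℓ y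
    ℓ∣rx-ry = ℤ∣.∣m+n∣n⇒∣m (subst (+ ℓ ℤ∣.∣_) x-y≡ ℓ∣x-y) (ℤ∣.∣n⇒∣m*n (qx ℤ.- qy) ℤ∣.∣-refl)

  ≈-via-diff : ∀ {x y x' y'} → x ℤ.- y ≡ x' ℤ.- y' → x' ≈ y' → x ≈ y
  ≈-via-diff e p = ∣⇒≈ (subst (+ ℓ ℤ∣.∣_) (sym e) (≈⇒∣ p))

  +-cong : ∀ {x x' y y'} → x ≈ x' → y ≈ y' → x ℤ.+ y ≈ x' ℤ.+ y'
  +-cong {x} {x'} {y} {y'} p q =
    ∣⇒≈ (subst (+ ℓ ℤ∣.∣_) (sym (diff x x' y y')) (ℤ∣.∣m∣n⇒∣m+n (≈⇒∣ p) (≈⇒∣ q)))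
    where
    diff : ∀ a a' b b' → (a ℤ.+ b) ℤ.- (a' ℤ.+ b') ≡ (a ℤ.- a') ℤ.+ (b ℤ.- b')
    diff = solve-∀

  *-cong : ∀ {x x' y y'} → x ≈ x' → y ≈ y' → x ℤ.* y ≈ x' ℤ.* y'
  *-cong {x} {x'} {y} {y'} p q =
    ∣⇒≈ (subst (+ ℓ ℤ∣.∣_) (sym (diff x x' y y'))
      (ℤ∣.∣m∣n⇒∣m+n (ℤ∣.∣n⇒∣m*n x (≈⇒∣ q)) (ℤ∣.∣m⇒∣m*n y' (≈⇒∣ p))))
    where
    diff : ∀ a a' b b' → a ℤ.* b ℤ.- a' ℤ.* b' ≡ a ℤ.* (b ℤ.- b') ℤ.+ (a ℤ.- a') ℤ.* b'
    diff = solve-∀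

  -‿cong : ∀ {x x'} → x ≈ x' → ℤ.- x ≈ ℤ.- x'
  -‿cong {x} {x'} p = ∣⇒≈ (subst (+ ℓ ℤ∣.∣_) (sym (diff x x')) (ℤ∣.∣m⇒∣-m (≈⇒∣ p)))
    where
    diff : ∀ a a' → ℤ.- a ℤ.- ℤ.- a' ≡ ℤ.- (a ℤ.- a')
    diff = solve-∀

  –-cong : ∀ {x x' y y'} → x ≈ x' → y ≈ y' → x ℤ.- y ≈ x' ℤ.- y'
  –-cong p q = +-cong p (-‿cong q)

  ^-cong : ∀ {x x'} n → x ≈ x' → x ℤ.^ n ≈ x' ℤ.^ n
  ^-cong zero    p = ≈-refl
  ^-cong (suc n) p = *-cong p (^-cong n p)

  *-congˡ : ∀ {x y y'} → y ≈ y' → x ℤ.* y ≈ x ℤ.* y'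
  *-congˡ {x} = *-cong {x} ≈-refl

  *-congʳ : ∀ {x x' y} → x ≈ x' → x ℤ.* y ≈ x' ℤ.* y
  *-congʳ {y = y} p = *-cong {y = y} p ≈-refl

  1≉0 : + 1 ≉ + 0
  1≉0 ()

  x≈0⇒x*y≈0 : ∀ {x} y → x ≈ + 0 → x ℤ.* y ≈ + 0
  x≈0⇒x*y≈0 {x} y x≈0 = ≈-trans (*-congʳ {y = y} x≈0) (≈-reflexive (ℤ.*-zeroˡ y))

  x-y≈0⇒x≈y : ∀ {x y} → x ℤ.- y ≈ + 0 → x ≈ y
  x-y≈0⇒x≈y {x} {y} = ≈-via-diff (sym (ℤ.+-identityʳ (x ℤ.- y)))

  ≈0⇒∣ : ∀ {x} → x ≈ + 0 → + ℓ ℤ∣.∣ x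
  ≈0⇒∣ {x} p = subst (+ ℓ ℤ∣.∣_) (ℤ.+-identityʳ x) (≈⇒∣ p)

  ∣⇒≈0 : ∀ {x} → + ℓ ℤ∣.∣ x → x ≈ + 0
  ∣⇒≈0 {x} p = ∣⇒≈ (subst (+ ℓ ℤ∣.∣_) (sym (ℤ.+-identityʳ x)) p)

  F : List ℤ
  F = elemsF ℓ

  ∈F⇒red-≡ : ∀ {x} → x ∈ F → + red ℓ x ≡ x
  ∈F⇒red-≡ x∈F with ∈-map⁻ +_ x∈F
  ... | n , n∈ , refl = cong +_ (m<n⇒m%n≡m (∈-upTo⁻ n∈))

  rep : ℤ → ℤ
  rep x = + red ℓ x

  rep-∈F : ∀ x → rep x ∈ F
  rep-∈F x = ∈-map⁺ +_ (∈-upTo⁺ (n%ℕd<d x ℓ))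

  rep-≈ : ∀ x → rep x ≈ x
  rep-≈ x = mk≈ (m<n⇒m%n≡m (n%ℕd<d x ℓ))

  ≈⇒≡-on-F : ∀ {x y} → x ∈ F → y ∈ F → x ≈ y → x ≡ y
  ≈⇒≡-on-F x∈F y∈F (mk≈ p) = trans (sym (∈F⇒red-≡ x∈F)) (trans (cong +_ p) (∈F⇒red-≡ y∈F))

  F-unique : Unique F
  F-unique = Unique.map⁺ (λ { refl → refl }) (Unique.upTo⁺ ℓ)

  length-F : length F ≡ ℓ
  length-F = trans (length-map +_ (upTo ℓ)) (length-upTo ℓ)

  count-F≤ℓ : ∀ p → count p F ≤ ℓ
  count-F≤ℓ p = ℕ.≤-trans (count-≤-length p F) (ℕ.≤-reflexive length-F)

  count-F≤1 : ∀ (p : ℤ → Bool) → (∀ {x y} → T (p x) → T (p y) → x ≈ y) → count p F ≤ 1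
  count-F≤1 p h = count-≤1 p F F-unique (λ x∈ y∈ tx ty → ≈⇒≡-on-F x∈ y∈ (h tx ty))

  count-≈-≤1 : ∀ c → count (λ x → eqF ℓ x c) F ≤ 1
  count-≈-≤1 c = count-F≤1 (λ x → eqF ℓ x c) (λ {x} {y} tx ty → ≈-trans (eqF⇒≈ {x} {c} tx) (≈-sym (eqF⇒≈ {y} {c} ty)))

  +[n+cℓ]≈+n : ∀ {m n} c → m ≡ n ℕ.+ c ℕ.* ℓ → + m ≈ + n
  +[n+cℓ]≈+n {m} {n} c refl = ∣⇒≈ (divides (+ c) (begin
      + (n ℕ.+ c ℕ.* ℓ) ℤ.- + n       ≡⟨ cong (ℤ._- + n) (ℤ.pos-+ n (c ℕ.* ℓ)) ⟩
      (+ n ℤ.+ + (c ℕ.* ℓ)) ℤ.- + n   ≡⟨ cong (λ z → (+ n ℤ.+ z) ℤ.- + n) (ℤ.pos-* c ℓ) ⟩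
      (+ n ℤ.+ + c ℤ.* + ℓ) ℤ.- + n   ≡⟨ cancel (+ n) (+ c ℤ.* + ℓ) ⟩
      + c ℤ.* + ℓ                     ∎))
    where
    open ≡-Reasoning
    cancel : ∀ a b → (a ℤ.+ b) ℤ.- a ≡ b
    cancel = solve-∀

  ∑-F-≤ : ∀ {f : ℤ → ℕ} c → (∀ {x} → x ∈ F → f x ≤ c) → ∑ F f ≤ ℓ * c
  ∑-F-≤ c h = ℕ.≤-trans (∑-≤-const F c h) (ℕ.≤-reflexive (cong (_* c) length-F))

  ∑-F-≤-split : ∀ {f : ℤ → ℕ} c c₀ → (∀ {x} → x ∈ F → x ≉ + 0 → f x ≤ c) → (∀ {x} → x ∈ F → f x ≤ c₀) →
    ∑ F f ≤ ℓ * c + c₀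
  ∑-F-≤-split {f} c c₀ h h₀ = begin
    ∑ F f                                                  ≤⟨ ∑-mono F bound ⟩
    ∑[ x ← F ] (c + ⟦ eqF ℓ x (+ 0) ⟧ * c₀)                ≡⟨ ∑-+ F (λ _ → c) _ ⟩
    ∑[ _ ← F ] c + ∑[ x ← F ] (⟦ eqF ℓ x (+ 0) ⟧ * c₀)     ≡⟨ cong₂ _+_ (trans (∑-const F c) (cong (_* c) length-F))
                                                                        (∑-*ʳ F c₀ (λ x → ⟦ eqF ℓ x (+ 0) ⟧)) ⟩
    ℓ * c + count (λ x → eqF ℓ x (+ 0)) F * c₀             ≤⟨ ℕ.+-monoʳ-≤ (ℓ * c) (ℕ.*-monoˡ-≤ c₀ (count-≈-≤1 (+ 0))) ⟩
    ℓ * c + 1 * c₀                                         ≡⟨ cong (_+_ (ℓ * c)) (ℕ.*-identityˡ c₀) ⟩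
    ℓ * c + c₀                                             ∎
    where
    open ℕ.≤-Reasoning
    bound : ∀ {x} → x ∈ F → f x ≤ c + ⟦ eqF ℓ x (+ 0) ⟧ * c₀
    bound {x} x∈F with x ≈? + 0
    ... | no  x≉0 = ℕ.≤-trans (h x∈F x≉0) (ℕ.m≤m+n c _)
    ... | yes x≈0 = ℕ.≤-trans (h₀ x∈F) (ℕ.≤-trans (ℕ.≤-reflexive (sym (trans
          (cong (_* c₀) (⟦⟧-true (≈⇒eqF {x} {+ 0} x≈0))) (ℕ.*-identityˡ c₀)))) (ℕ.m≤n+m _ c))

  ∑-F-≥-nonzero : ∀ {f : ℤ → ℕ} c → (∀ {x} → x ∈ F → x ≉ + 0 → c ≤ f x) → suc k * c ≤ ∑ F f
  ∑-F-≥-nonzero {f} c h = ℕ.+-cancelˡ-≤ c (suc k * c) (∑ F f) (begin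
    ℓ * c                                                  ≡⟨ cong (_* c) length-F ⟨
    length F * c                                           ≤⟨ ∑-≥-const F c bound ⟩
    ∑[ x ← F ] (f x + ⟦ eqF ℓ x (+ 0) ⟧ * c)               ≡⟨ ∑-+ F f _ ⟩
    ∑ F f + ∑[ x ← F ] (⟦ eqF ℓ x (+ 0) ⟧ * c)             ≡⟨ cong (_+_ (∑ F f)) (∑-*ʳ F c (λ x → ⟦ eqF ℓ x (+ 0) ⟧)) ⟩
    ∑ F f + count (λ x → eqF ℓ x (+ 0)) F * c              ≤⟨ ℕ.+-monoʳ-≤ (∑ F f) (ℕ.*-monoˡ-≤ c (count-≈-≤1 (+ 0))) ⟩
    ∑ F f + 1 * c                                          ≡⟨ ℕ.+-comm (∑ F f) (1 * c) ⟩
    1 * c + ∑ F f                                          ≡⟨ cong (λ z → z + ∑ F f) (ℕ.*-identityˡ c) ⟩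
    c + ∑ F f                                              ∎)
    where
    open ℕ.≤-Reasoning
    bound : ∀ {x} → x ∈ F → c ≤ f x + ⟦ eqF ℓ x (+ 0) ⟧ * c
    bound {x} x∈F with x ≈? + 0
    ... | no  x≉0 = ℕ.≤-trans (h x∈F x≉0) (ℕ.m≤m+n (f x) _)
    ... | yes x≈0 = ℕ.≤-trans (ℕ.≤-reflexive (sym (trans
          (cong (_* c) (⟦⟧-true (≈⇒eqF {x} {+ 0} x≈0))) (ℕ.*-identityˡ c)))) (ℕ.m≤n+m _ (f x))

  ∑-F-≥ : ∀ {f : ℤ → ℕ} c → (∀ {x} → x ∈ F → c ≤ f x) → ℓ * c ≤ ∑ F f
  ∑-F-≥ c h = ℕ.≤-trans (ℕ.≤-reflexive (cong (_* c) (sym length-F))) (∑-≥-const F c h)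

  count-by-value : ∀ {A : Set} (xs : List A) (good : ℤ → Bool) (fibre : ℤ → A → Bool) {q : A → Bool} B →
    (∀ {u v} → u ≈ v → T (good u) → T (good v)) →
    (∀ {u v x} → u ≈ v → T (fibre u x) → T (fibre v x)) →
    (∀ {x} → x ∈ xs → T (q x) → ∃ λ e → T (good e) × T (fibre e x)) →
    (∀ e → count (fibre e) xs ≤ B) →
    count q xs ≤ count good F * B
  count-by-value xs good fibre {q} B good-resp fibre-resp witness fibre-≤ = begin
    count q xs
      ≤⟨ union-bound xs F q (λ e x → good e ∧ fibre e x) canonical ⟩
    ∑[ e ← F ] count (λ x → good e ∧ fibre e x) xs
      ≡⟨ ∑-cong F (λ {e} _ → count-∧ˡ xs (good e) (fibre e)) ⟩
    ∑[ e ← F ] (⟦ good e ⟧ * count (fibre e) xs)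
      ≤⟨ ∑-mono F (λ {e} _ → ℕ.*-monoʳ-≤ ⟦ good e ⟧ (fibre-≤ e)) ⟩
    ∑[ e ← F ] (⟦ good e ⟧ * B)
      ≡⟨ ∑-*ʳ F B (λ e → ⟦ good e ⟧) ⟩
    count good F * B ∎
    where
    open ℕ.≤-Reasoning
    canonical : ∀ {x} → x ∈ xs → T (q x) → ∃ λ e → e ∈ F × T (good e ∧ fibre e x)
    canonical x∈xs t with witness x∈xs t
    ... | e , g , φ = rep e , rep-∈F e ,
      ∧-intro {good (rep e)} (good-resp (≈-sym (rep-≈ e)) g) (fibre-resp (≈-sym (rep-≈ e)) φ)

module Field (k : ℕ) (prime : Prime (suc (suc k))) where
  open Residues k public

  x*y≈0⇒x≈0⊎y≈0 : ∀ x y → x ℤ.* y ≈ + 0 → x ≈ + 0 ⊎ y ≈ + 0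
  x*y≈0⇒x≈0⊎y≈0 x y p = Sum.map (λ ℓ∣x → ∣⇒≈0 (ℤ∣.∣ᵤ⇒∣ ℓ∣x)) (λ ℓ∣y → ∣⇒≈0 (ℤ∣.∣ᵤ⇒∣ ℓ∣y))
    (euclidsLemma ∣ x ∣ ∣ y ∣ prime (subst (ℓ ℕ∣.∣_) (ℤ.abs-* x y) (ℤ∣.∣⇒∣ᵤ (≈0⇒∣ p))))

  *-≉0 : ∀ {x y} → x ≉ + 0 → y ≉ + 0 → x ℤ.* y ≉ + 0
  *-≉0 {x} {y} x≉0 y≉0 xy≈0 = [ x≉0 , y≉0 ]′ (x*y≈0⇒x≈0⊎y≈0 x y xy≈0)

  ^-≉0 : ∀ {x} n → x ≉ + 0 → x ℤ.^ n ≉ + 0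
  ^-≉0 zero    x≉0 = 1≉0
  ^-≉0 (suc n) x≉0 = *-≉0 x≉0 (^-≉0 n x≉0)

  x^n≈0⇒x≈0 : ∀ {x} n → x ℤ.^ n ≈ + 0 → x ≈ + 0
  x^n≈0⇒x≈0 {x} n xⁿ≈0 with x ≈? + 0
  ... | yes x≈0 = x≈0
  ... | no  x≉0 = ⊥-elim (^-≉0 n x≉0 xⁿ≈0)

  *-cancelˡ-≈ : ∀ {x y z} → x ≉ + 0 → x ℤ.* y ≈ x ℤ.* z → y ≈ z
  *-cancelˡ-≈ {x} {y} {z} x≉0 xy≈xz = [ (λ x≈0 → ⊥-elim (x≉0 x≈0)) , x-y≈0⇒x≈y ]′
      (x*y≈0⇒x≈0⊎y≈0 x (y ℤ.- z) (≈-via-diff (factor x y z) xy≈xz))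
    where
    factor : ∀ a b c → a ℤ.* (b ℤ.- c) ℤ.- + 0 ≡ a ℤ.* b ℤ.- a ℤ.* c
    factor = solve-∀

  ≉0⇒invertible : ∀ {x} → x ≉ + 0 → ∃ λ u → u ℤ.* x ≈ + 1
  ≉0⇒invertible {x} x≉0 with coprime-Bézout (prime⇒coprime prime {{r≢0}} (n%ℕd<d x ℓ))
    where
    r≢0 : ℕ.NonZero (red ℓ x)
    r≢0 = ℕ.≢-nonZero (λ r≡0 → x≉0 (mk≈ r≡0))
  ... | Bézout.-+ a b eq = + b , (begin
      + b ℤ.* x                 ≈⟨ *-congˡ {+ b} (≈-sym (rep-≈ x)) ⟩
      + b ℤ.* + red ℓ x         ≡⟨ ℤ.pos-* b (red ℓ x) ⟨
      + (b ℕ.* red ℓ x)         ≈⟨ +[n+cℓ]≈+n a (sym eq) ⟩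
      + 1                       ∎)
    where open ≈-Reasoning
  ... | Bézout.+- a b eq = ℤ.- + b , (begin
      ℤ.- + b ℤ.* x             ≈⟨ *-congˡ {ℤ.- + b} (≈-sym (rep-≈ x)) ⟩
      ℤ.- + b ℤ.* + red ℓ x     ≈⟨ ≈-via-diff (negate (+ b) (+ red ℓ x)) (≈-sym 1+br≈0) ⟩
      + 1                       ∎)
    where
    open ≈-Reasoning
    negate : ∀ u v → ℤ.- u ℤ.* v ℤ.- + 1 ≡ + 0 ℤ.- (+ 1 ℤ.+ u ℤ.* v)
    negate = solve-∀
    1+br≈0 : + 1 ℤ.+ + b ℤ.* + red ℓ x ≈ + 0
    1+br≈0 = ≈-trans (≈-reflexive (cong (ℤ._+_ (+ 1)) (sym (ℤ.pos-* b (red ℓ x)))))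
             (+[n+cℓ]≈+n a eq)

-- Polynomials over ℤ are coefficient lists, constant term first.
eval : List ℤ → ℤ → ℤ
eval []       x = + 0
eval (c ∷ cs) x = c ℤ.+ x ℤ.* eval cs x

-- The quotient of cs by X - r.
quot : ℤ → List ℤ → List ℤ
quot r []            = []
quot r (c ∷ [])      = []
quot r (c ∷ c' ∷ cs) = eval (c' ∷ cs) r ∷ quot r (c' ∷ cs)

length-quot : ∀ r c cs → length (quot r (c ∷ cs)) ≡ length cs
length-quot r c []        = refl
length-quot r c (c' ∷ cs) = cong suc (length-quot r c' cs)

eval-quot : ∀ r cs x → eval cs x ≡ eval cs r ℤ.+ (x ℤ.- r) ℤ.* eval (quot r cs) x
eval-quot r []            x = step (x ℤ.- r)
  where
  step : ∀ a → + 0 ≡ + 0 ℤ.+ a ℤ.* + 0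
  step = solve-∀
eval-quot r (c ∷ [])      x = step c x r
  where
  step : ∀ c x r → c ℤ.+ x ℤ.* + 0 ≡ c ℤ.+ r ℤ.* + 0 ℤ.+ (x ℤ.- r) ℤ.* + 0
  step = solve-∀
eval-quot r (c ∷ c' ∷ cs) x =
  trans (cong (λ z → c ℤ.+ x ℤ.* z) (eval-quot r (c' ∷ cs) x))
        (step c x r (eval (c' ∷ cs) r) (eval (quot r (c' ∷ cs)) x))
  where
  step : ∀ c x r e q → c ℤ.+ x ℤ.* (e ℤ.+ (x ℤ.- r) ℤ.* q) ≡ c ℤ.+ r ℤ.* e ℤ.+ (x ℤ.- r) ℤ.* (e ℤ.+ x ℤ.* q)
  step = solve-∀

monomial : ℤ → ℕ → List ℤ
monomial a zero    = a ∷ []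
monomial a (suc m) = + 0 ∷ monomial a m

length-monomial : ∀ a m → length (monomial a m) ≡ suc m
length-monomial a zero    = refl
length-monomial a (suc m) = cong suc (length-monomial a m)

eval-monomial : ∀ a m x → eval (monomial a m) x ≡ a ℤ.* x ℤ.^ m
eval-monomial a zero    x = step a x
  where
  step : ∀ a x → a ℤ.+ x ℤ.* + 0 ≡ a ℤ.* + 1
  step = solve-∀
eval-monomial a (suc m) x = trans (cong (λ z → + 0 ℤ.+ x ℤ.* z) (eval-monomial a m x)) (step a x (x ℤ.^ m))
  where
  step : ∀ a x y → + 0 ℤ.+ x ℤ.* (a ℤ.* y) ≡ a ℤ.* (x ℤ.* y)
  step = solve-∀

module Roots (k : ℕ) (prime : Prime (suc (suc k))) where
  open Field k prime

  IsZero : List ℤ → Set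
  IsZero = All (_≈ + 0)

  isRoot : List ℤ → ℤ → Bool
  isRoot cs x = eqF ℓ (eval cs x) (+ 0)

  private
    c≡c+r*0 : ∀ c r → c ≡ c ℤ.+ r ℤ.* + 0
    c≡c+r*0 = solve-∀

  quot-zero⇒zero : ∀ r cs → eval cs r ≈ + 0 → IsZero (quot r cs) → IsZero cs
  quot-zero⇒zero r []            _    _          = []
  quot-zero⇒zero r (c ∷ [])      root _          = ≈-trans (≈-reflexive (c≡c+r*0 c r)) root ∷ []
  quot-zero⇒zero r (c ∷ c' ∷ cs) root (q≈0 ∷ qs) = c≈0 ∷ quot-zero⇒zero r (c' ∷ cs) q≈0 qs
    where
    c≈0 : c ≈ + 0
    c≈0 = ≈-trans (≈-reflexive (c≡c+r*0 c r))
            (≈-trans (+-cong {c} ≈-refl (*-congˡ {r} (≈-sym q≈0))) root)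

  root-split : ∀ r cs x → eval cs r ≈ + 0 → eval cs x ≈ + 0 → x ≈ r ⊎ eval (quot r cs) x ≈ + 0
  root-split r cs x r-root x-root =
    Sum.map₁ x-y≈0⇒x≈y (x*y≈0⇒x≈0⊎y≈0 (x ℤ.- r) (eval (quot r cs) x) product≈0)
    where
    rearrange : ∀ a b c → a ℤ.* b ℤ.- + 0 ≡ (c ℤ.+ a ℤ.* b) ℤ.- c
    rearrange = solve-∀
    product≈0 : (x ℤ.- r) ℤ.* eval (quot r cs) x ≈ + 0
    product≈0 = ≈-via-diff
      (trans (rearrange (x ℤ.- r) (eval (quot r cs) x) (eval cs r))
             (cong (ℤ._- eval cs r) (sym (eval-quot r cs x))))
      (≈-trans x-root (≈-sym r-root))

  roots-≤ : ∀ m cs → length cs ≡ suc m → ¬ IsZero cs → count (isRoot cs) F ≤ m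
  roots-≤ m []       ()
  roots-≤ m (c ∷ cs) len cs≉0 with count-zero-or-witness (isRoot (c ∷ cs)) F
  ... | inj₁ none           = ℕ.≤-trans (ℕ.≤-reflexive none) z≤n
  ... | inj₂ (r , _ , root) = remove-root m (trans (length-quot r c cs) (ℕ.suc-injective len))
    where
    r-root : eval (c ∷ cs) r ≈ + 0
    r-root = eqF⇒≈ {eval (c ∷ cs) r} {+ 0} root
    q = quot r (c ∷ cs)
    q≉0 : ¬ IsZero q
    q≉0 q≈0 = cs≉0 (quot-zero⇒zero r (c ∷ cs) r-root q≈0)
    remove-root : ∀ m → length q ≡ m → count (isRoot (c ∷ cs)) F ≤ m
    remove-root zero    len-q = ⊥-elim (q≉0 (empty q len-q))
      where
      empty : ∀ xs → length xs ≡ 0 → IsZero xs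
      empty [] _ = []
    remove-root (suc m) len-q = begin
      count (isRoot (c ∷ cs)) F
        ≤⟨ count-∨ F (λ {x} _ t → Sum.map (≈⇒eqF {x} {r}) (≈⇒eqF {eval q x} {+ 0})
             (root-split r (c ∷ cs) x r-root (eqF⇒≈ {eval (c ∷ cs) x} {+ 0} t))) ⟩
      count (λ x → eqF ℓ x r) F ℕ.+ count (isRoot q) F
        ≤⟨ ℕ.+-mono-≤ (count-≈-≤1 r) (roots-≤ m q len-q q≉0) ⟩
      suc m ∎
      where open ℕ.≤-Reasoning

  binomial-roots-≤ : ∀ {a} m e → a ≉ + 0 → count (λ x → eqF ℓ (a ℤ.* x ℤ.^ suc m) e) F ≤ suc m
  binomial-roots-≤ {a} m e a≉0 = ℕ.≤-trans (count-mono F {q = isRoot binomial} is-root)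
      (roots-≤ (suc m) binomial (cong suc (length-monomial a m)) binomial≉0)
    where
    binomial = ℤ.- e ∷ monomial a m
    leading : ∀ m → IsZero (monomial a m) → a ≈ + 0
    leading zero    (a≈0 ∷ []) = a≈0
    leading (suc m) (_ ∷ zs)   = leading m zs
    binomial≉0 : ¬ IsZero binomial
    binomial≉0 (_ ∷ zs) = a≉0 (leading m zs)
    eval-binomial : ∀ x → eval binomial x ℤ.- + 0 ≡ a ℤ.* x ℤ.^ suc m ℤ.- e
    eval-binomial x = trans (cong (λ z → (ℤ.- e ℤ.+ x ℤ.* z) ℤ.- + 0) (eval-monomial a m x))
                            (step e x a (x ℤ.^ m))
      where
      step : ∀ e x a y → (ℤ.- e ℤ.+ x ℤ.* (a ℤ.* y)) ℤ.- + 0 ≡ a ℤ.* (x ℤ.* y) ℤ.- e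
      step = solve-∀
    is-root : ∀ {x} → x ∈ F → T (eqF ℓ (a ℤ.* x ℤ.^ suc m) e) → T (isRoot binomial x)
    is-root {x} _ t = ≈⇒eqF {eval binomial x} {+ 0}
      (≈-via-diff (eval-binomial x) (eqF⇒≈ {a ℤ.* x ℤ.^ suc m} {e} t))

module Matrices (k : ℕ) (prime : Prime (suc (suc k))) where
  open Field k prime public
  open Roots k prime public

  GL : List Mat
  GL = GL2 ℓ

  Quad : List Mat
  Quad = concatMap (λ x → concatMap (λ y → concatMap (λ z → map (mat x y z) F) F) F) F

  nondegenerate : Mat → Bool
  nondegenerate M = not (eqF ℓ (det M) (+ 0))

  count-GL : ∀ p → count p GL ≡
    ∑[ x ← F ] ∑[ y ← F ] ∑[ z ← F ] count (λ w → nondegenerate (mat x y z w) ∧ p (mat x y z w)) F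
  count-GL p = trans (count-filterᵇ nondegenerate p Quad)
    (trans (∑-concatMap (λ x → concatMap (λ y → concatMap (λ z → map (mat x y z) F) F) F) F f)
    (∑-cong F (λ {x} _ → trans (∑-concatMap (λ y → concatMap (λ z → map (mat x y z) F) F) F f)
    (∑-cong F (λ {y} _ → trans (∑-concatMap (λ z → map (mat x y z) F) F f)
    (∑-cong F (λ {z} _ → ∑-map (mat x y z) F f)))))))
    where
    f : Mat → ℕ
    f M = ⟦ nondegenerate M ∧ p M ⟧

  count-GL-≤ : ∀ p → count p GL ≤ ∑[ x ← F ] ∑[ y ← F ] ∑[ z ← F ] count (λ w → p (mat x y z w)) F
  count-GL-≤ p = ℕ.≤-trans (ℕ.≤-reflexive (count-GL p))
    (∑-mono F (λ {x} _ → ∑-mono F (λ {y} _ → ∑-mono F (λ {z} _ →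
      count-mono F {λ w → nondegenerate (mat x y z w) ∧ p (mat x y z w)} {λ w → p (mat x y z w)}
        (λ {w} _ → ∧-elimʳ {nondegenerate (mat x y z w)})))))

  GL-det≉0 : ∀ {M} → M ∈ GL → det M ≉ + 0
  GL-det≉0 {M} M∈GL det≈0 =
    not-elim (proj₂ (∈-filter⁻ (λ M → T? (nondegenerate M)) {xs = Quad} M∈GL)) (≈⇒eqF {det M} {+ 0} det≈0)

  det-determines-d : ∀ {x y z w₁ w₂ e} → x ≉ + 0 →
    det (mat x y z w₁) ≈ e → det (mat x y z w₂) ≈ e → w₁ ≈ w₂
  det-determines-d {x} {y} {z} {w₁} {w₂} x≉0 p q =
    *-cancelˡ-≈ x≉0 (≈-via-diff (shift (x ℤ.* w₁) (x ℤ.* w₂) (y ℤ.* z)) (≈-trans p (≈-sym q)))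
    where
    shift : ∀ a b c → a ℤ.- b ≡ (a ℤ.- c) ℤ.- (b ℤ.- c)
    shift = solve-∀

  det-determines-c : ∀ {x y z₁ z₂ w e} → y ≉ + 0 →
    det (mat x y z₁ w) ≈ e → det (mat x y z₂ w) ≈ e → z₁ ≈ z₂
  det-determines-c {x} {y} {z₁} {z₂} {w} y≉0 p q =
    *-cancelˡ-≈ y≉0 (≈-via-diff (shift (y ℤ.* z₁) (y ℤ.* z₂) (x ℤ.* w)) (≈-trans q (≈-sym p)))
    where
    shift : ∀ a b c → a ℤ.- b ≡ (c ℤ.- b) ℤ.- (c ℤ.- a)
    shift = solve-∀

  tr-determines-d : ∀ {x y z w₁ w₂ t} → tr (mat x y z w₁) ≈ t → tr (mat x y z w₂) ≈ t → w₁ ≈ w₂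
  tr-determines-d {x} {y} {z} {w₁} {w₂} p q = ≈-via-diff (shift x w₁ w₂) (≈-trans p (≈-sym q))
    where
    shift : ∀ a u v → u ℤ.- v ≡ (a ℤ.+ u) ℤ.- (a ℤ.+ v)
    shift = solve-∀

  count-det-≤ : ∀ e → count (λ M → eqF ℓ (det M) e) GL ≤ 2 * ℓ ^ 3
  count-det-≤ e = begin
    count p GL
      ≤⟨ count-GL-≤ p ⟩
    ∑[ x ← F ] ∑[ y ← F ] ∑[ z ← F ] count (λ w → p (mat x y z w)) F
      ≤⟨ ∑-F-≤-split (ℓ * (ℓ * 1)) (ℓ * (ℓ * ℓ))
           (λ {x} _ x≉0 → ∑-F-≤ (ℓ * 1) (λ {y} _ → ∑-F-≤ 1 (λ {z} _ → count-F≤1 (λ w → p (mat x y z w))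
             (λ {w₁} {w₂} t₁ t₂ → det-determines-d {x} {y} {z} x≉0
               (eqF⇒≈ {det (mat x y z w₁)} {e} t₁) (eqF⇒≈ {det (mat x y z w₂)} {e} t₂)))))
           (λ {x} _ → ∑-F-≤ (ℓ * ℓ) (λ {y} _ → ∑-F-≤ ℓ (λ {z} _ → count-F≤ℓ (λ w → p (mat x y z w))))) ⟩
    ℓ * (ℓ * (ℓ * 1)) + ℓ * (ℓ * ℓ)
      ≡⟨ arith ℓ ⟩
    2 * ℓ ^ 3 ∎
    where
    open ℕ.≤-Reasoning
    p : Mat → Bool
    p M = eqF ℓ (det M) e
    arith : ∀ l → l * (l * (l * 1)) + l * (l * l) ≡ 2 * (l * (l * (l * 1)))
    arith = ℕ-Solver.solve-∀

  count-tr-≤ : ∀ t → count (λ M → eqF ℓ (tr M) t) GL ≤ ℓ ^ 3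
  count-tr-≤ t = ℕ.≤-trans (count-GL-≤ p)
    (∑-F-≤ (ℓ * (ℓ * 1)) (λ {x} _ → ∑-F-≤ (ℓ * 1) (λ {y} _ → ∑-F-≤ 1 (λ {z} _ →
      count-F≤1 (λ w → p (mat x y z w)) (λ {w₁} {w₂} t₁ t₂ → tr-determines-d {x} {y} {z}
        (eqF⇒≈ {tr (mat x y z w₁)} {t} t₁) (eqF⇒≈ {tr (mat x y z w₂)} {t} t₂))))))
    where
    p : Mat → Bool
    p M = eqF ℓ (tr M) t

  count-det-tr-≤ : ∀ e t → count (λ M → eqF ℓ (det M) e ∧ eqF ℓ (tr M) t) GL ≤ 2 * ℓ ^ 2
  count-det-tr-≤ e t = begin
    count p GL
      ≤⟨ count-GL-≤ p ⟩
    ∑[ x ← F ] ∑[ y ← F ] ∑[ z ← F ] count (λ w → p (mat x y z w)) F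
      ≤⟨ ∑-F-≤ (ℓ * 1 + ℓ) (λ {x} _ → ℕ.≤-trans
           (∑-mono F (λ {y} _ → ∑-mono F (λ {z} _ → at-most-one-d x y z)))
           (∑-F-≤-split 1 ℓ
             (λ {y} _ y≉0 → count-F≤1 (q x y) (λ {z₁} {z₂} t₁ t₂ → det-determines-c {x} {y} y≉0
               (eqF⇒≈ {det (mat x y z₁ (t ℤ.- x))} {e} t₁) (eqF⇒≈ {det (mat x y z₂ (t ℤ.- x))} {e} t₂)))
             (λ {y} _ → count-F≤ℓ (q x y)))) ⟩
    ℓ * (ℓ * 1 + ℓ)
      ≡⟨ arith ℓ ⟩
    2 * ℓ ^ 2 ∎
    where
    open ℕ.≤-Reasoning
    p : Mat → Bool
    p M = eqF ℓ (det M) e ∧ eqF ℓ (tr M) t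
    q : ℤ → ℤ → ℤ → Bool
    q x y z = eqF ℓ (det (mat x y z (t ℤ.- x))) e
    arith : ∀ l → l * (l * 1 + l) ≡ 2 * (l * (l * 1))
    arith = ℕ-Solver.solve-∀
    d≈t-a : ∀ {x w} → x ℤ.+ w ≈ t → t ℤ.- x ≈ w
    d≈t-a {x} {w} x+w≈t = ≈-via-diff (shift t x w) (≈-sym x+w≈t)
      where
      shift : ∀ t x w → (t ℤ.- x) ℤ.- w ≡ t ℤ.- (x ℤ.+ w)
      shift = solve-∀
    at-most-one-d : ∀ x y z → count (λ w → p (mat x y z w)) F ≤ ⟦ q x y z ⟧
    at-most-one-d x y z = count-≤-⟦⟧ (λ w → p (mat x y z w)) F (q x y z)
      (count-F≤1 (λ w → p (mat x y z w)) (λ {w₁} {w₂} t₁ t₂ → tr-determines-d {x} {y} {z}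
        (eqF⇒≈ {tr (mat x y z w₁)} {t} (∧-elimʳ {eqF ℓ (det (mat x y z w₁)) e} t₁))
        (eqF⇒≈ {tr (mat x y z w₂)} {t} (∧-elimʳ {eqF ℓ (det (mat x y z w₂)) e} t₂))))
      (λ {w} _ tw → ≈⇒eqF {det (mat x y z (t ℤ.- x))} {e} (≈-trans
        (–-cong {x ℤ.* (t ℤ.- x)} {x ℤ.* w} {y ℤ.* z} (*-congˡ {x}
          (d≈t-a (eqF⇒≈ {tr (mat x y z w)} {t} (∧-elimʳ {eqF ℓ (det (mat x y z w)) e} tw)))) ≈-refl)
        (eqF⇒≈ {det (mat x y z w)} {e} (∧-elimˡ {eqF ℓ (det (mat x y z w)) e} tw))))

  count-det-≥ : ∀ e → e ≉ + 0 → suc k * ℓ ^ 2 ≤ count (λ M → eqF ℓ (det M) e) GL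
  count-det-≥ e e≉0 = ℕ.≤-trans
    (∑-F-≥-nonzero (ℓ * (ℓ * 1)) (λ {x} _ x≉0 → ∑-F-≥ (ℓ * 1) (λ {y} _ → ∑-F-≥ 1 (λ {z} _ →
      solution x y z x≉0))))
    (ℕ.≤-reflexive (sym (count-GL p)))
    where
    p : Mat → Bool
    p M = eqF ℓ (det M) e
    solution : ∀ x y z → x ≉ + 0 → 1 ≤ count (λ w → nondegenerate (mat x y z w) ∧ p (mat x y z w)) F
    solution x y z x≉0 with ≉0⇒invertible x≉0
    ... | u , ux≈1 = count-member (λ w → nondegenerate (mat x y z w) ∧ p (mat x y z w)) (rep-∈F (u ℤ.* (e ℤ.+ y ℤ.* z)))
        (∧-intro {nondegenerate (mat x y z w₀)}
          (not-intro (λ t → e≉0 (≈-trans (≈-sym det≈e) (eqF⇒≈ {det (mat x y z w₀)} {+ 0} t))))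
          (≈⇒eqF {det (mat x y z w₀)} {e} det≈e))
      where
      open ≈-Reasoning
      w₀ = rep (u ℤ.* (e ℤ.+ y ℤ.* z))
      regroup : ∀ x u s → x ℤ.* (u ℤ.* s) ≡ (u ℤ.* x) ℤ.* s
      regroup = solve-∀
      cancel : ∀ e s → (e ℤ.+ s) ℤ.- s ≡ e
      cancel = solve-∀
      det≈e : det (mat x y z w₀) ≈ e
      det≈e = begin
        x ℤ.* w₀ ℤ.- y ℤ.* z                          ≈⟨ –-cong {y = y ℤ.* z} (*-congˡ {x} (rep-≈ _)) ≈-refl ⟩
        x ℤ.* (u ℤ.* (e ℤ.+ y ℤ.* z)) ℤ.- y ℤ.* z     ≡⟨ cong (ℤ._- y ℤ.* z) (regroup x u _) ⟩
        (u ℤ.* x) ℤ.* (e ℤ.+ y ℤ.* z) ℤ.- y ℤ.* z     ≈⟨ –-cong {y = y ℤ.* z} (*-congʳ ux≈1) ≈-refl ⟩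
        + 1 ℤ.* (e ℤ.+ y ℤ.* z) ℤ.- y ℤ.* z           ≡⟨ cong (ℤ._- y ℤ.* z) (ℤ.*-identityˡ (e ℤ.+ y ℤ.* z)) ⟩
        (e ℤ.+ y ℤ.* z) ℤ.- y ℤ.* z                   ≡⟨ cancel e (y ℤ.* z) ⟩
        e                                             ∎

  length-GL-≤ : length GL ≤ ℓ ^ 4
  length-GL-≤ = begin
    length GL
      ≡⟨ trans (∑-const GL 1) (ℕ.*-identityʳ (length GL)) ⟨
    count (λ _ → true) GL
      ≤⟨ count-GL-≤ (λ _ → true) ⟩
    ∑[ x ← F ] ∑[ y ← F ] ∑[ z ← F ] count (λ _ → true) F
      ≡⟨ count-∧⁴ F always always always always ⟩
    count always F * (count always F * (count always F * count always F))
      ≤⟨ ℕ.*-mono-≤ ≤ℓ (ℕ.*-mono-≤ ≤ℓ (ℕ.*-mono-≤ ≤ℓ (ℕ.≤-trans ≤ℓ (ℕ.≤-reflexive (sym (ℕ.*-identityʳ ℓ)))))) ⟩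
    ℓ ^ 4 ∎
    where
    open ℕ.≤-Reasoning
    always : ℤ → Bool
    always _ = true
    ≤ℓ = count-F≤ℓ always

  count-eqMat-≤1 : ∀ P → count (λ N → eqMat ℓ N P) GL ≤ 1
  count-eqMat-≤1 P = begin
    count (λ N → eqMat ℓ N P) GL
      ≤⟨ count-GL-≤ (λ N → eqMat ℓ N P) ⟩
    ∑[ x ← F ] ∑[ y ← F ] ∑[ z ← F ] count (λ w → eqMat ℓ (mat x y z w) P) F
      ≡⟨ count-∧⁴ F (λ x → eqF ℓ x (a P)) (λ y → eqF ℓ y (b P)) (λ z → eqF ℓ z (c P)) (λ w → eqF ℓ w (d P)) ⟩
    count (λ x → eqF ℓ x (a P)) F * (count (λ y → eqF ℓ y (b P)) F *
      (count (λ z → eqF ℓ z (c P)) F * count (λ w → eqF ℓ w (d P)) F))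
      ≤⟨ ℕ.*-mono-≤ (count-≈-≤1 (a P)) (ℕ.*-mono-≤ (count-≈-≤1 (b P))
           (ℕ.*-mono-≤ (count-≈-≤1 (c P)) (count-≈-≤1 (d P)))) ⟩
    1 ∎
    where open ℕ.≤-Reasoning

  power-roots-≤ : ∀ n e → count (λ x → eqF ℓ (x ℤ.^ suc n) e) F ≤ suc n
  power-roots-≤ n e = ℕ.≤-trans
    (count-mono F {q = λ x → eqF ℓ (+ 1 ℤ.* x ℤ.^ suc n) e} (λ {x} _ t →
      eqF-resp {x ℤ.^ suc n} {+ 1 ℤ.* x ℤ.^ suc n} {e} (≈-reflexive (sym (ℤ.*-identityˡ (x ℤ.^ suc n)))) ≈-refl t))
    (binomial-roots-≤ n e 1≉0)

  scalarMultiple : ℕ → Mat → Mat → Bool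
  scalarMultiple n M N = any (λ ζ → inMu ℓ n ζ ∧ eqMat ℓ N (scale ζ M)) F

  count-scalarMultiple-≤ : ∀ n M → count (scalarMultiple (suc n) M) GL ≤ suc n
  count-scalarMultiple-≤ n M = begin
    count (scalarMultiple (suc n) M) GL
      ≤⟨ union-bound GL F (scalarMultiple (suc n) M) q (λ {N} _ t → find (any⁻ (λ ζ → q ζ N) F t)) ⟩
    ∑[ ζ ← F ] count (q ζ) GL
      ≡⟨ ∑-cong F (λ {ζ} _ → count-∧ˡ GL (inMu ℓ (suc n) ζ) (λ N → eqMat ℓ N (scale ζ M))) ⟩
    ∑[ ζ ← F ] (⟦ inMu ℓ (suc n) ζ ⟧ * count (λ N → eqMat ℓ N (scale ζ M)) GL)
      ≤⟨ ∑-mono F (λ {ζ} _ → ℕ.*-monoʳ-≤ ⟦ inMu ℓ (suc n) ζ ⟧ (count-eqMat-≤1 (scale ζ M))) ⟩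
    ∑[ ζ ← F ] (⟦ inMu ℓ (suc n) ζ ⟧ * 1)
      ≡⟨ trans (∑-*ʳ F 1 (λ ζ → ⟦ inMu ℓ (suc n) ζ ⟧)) (ℕ.*-identityʳ _) ⟩
    count (inMu ℓ (suc n)) F
      ≤⟨ power-roots-≤ n (+ 1) ⟩
    suc n ∎
    where
    open ℕ.≤-Reasoning
    q : ℤ → Mat → Bool
    q ζ N = inMu ℓ (suc n) ζ ∧ eqMat ℓ N (scale ζ M)

  infix 4 _≈ᴹ_
  record _≈ᴹ_ (M N : Mat) : Set where
    constructor mk≈ᴹ
    field
      a≈ : a M ≈ a N
      b≈ : b M ≈ b N
      c≈ : c M ≈ c N
      d≈ : d M ≈ d N

  eqMat⇒≈ᴹ : ∀ {M N} → T (eqMat ℓ M N) → M ≈ᴹ N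
  eqMat⇒≈ᴹ {M} {N} t = mk≈ᴹ
    (eqF⇒≈ {a M} {a N} (∧-elimˡ {eqF ℓ (a M) (a N)} t))
    (eqF⇒≈ {b M} {b N} (∧-elimˡ {eqF ℓ (b M) (b N)} t₂))
    (eqF⇒≈ {c M} {c N} (∧-elimˡ {eqF ℓ (c M) (c N)} t₃))
    (eqF⇒≈ {d M} {d N} (∧-elimʳ {eqF ℓ (c M) (c N)} t₃))
    where
    t₂ = ∧-elimʳ {eqF ℓ (a M) (a N)} t
    t₃ = ∧-elimʳ {eqF ℓ (b M) (b N)} t₂

  ≈ᴹ⇒eqMat : ∀ {M N} → M ≈ᴹ N → T (eqMat ℓ M N)
  ≈ᴹ⇒eqMat {M} {N} (mk≈ᴹ a≈ b≈ c≈ d≈) =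
    ∧-intro {eqF ℓ (a M) (a N)} (≈⇒eqF {a M} a≈) (∧-intro {eqF ℓ (b M) (b N)} (≈⇒eqF {b M} b≈)
      (∧-intro {eqF ℓ (c M) (c N)} (≈⇒eqF {c M} c≈) (≈⇒eqF {d M} d≈)))

  ≈ᴹ-refl : ∀ {M} → M ≈ᴹ M
  ≈ᴹ-refl = mk≈ᴹ ≈-refl ≈-refl ≈-refl ≈-refl

  ≈ᴹ-sym : ∀ {M N} → M ≈ᴹ N → N ≈ᴹ M
  ≈ᴹ-sym (mk≈ᴹ a≈ b≈ c≈ d≈) = mk≈ᴹ (≈-sym a≈) (≈-sym b≈) (≈-sym c≈) (≈-sym d≈)

  ≈ᴹ-trans : ∀ {L M N} → L ≈ᴹ M → M ≈ᴹ N → L ≈ᴹ N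
  ≈ᴹ-trans (mk≈ᴹ a₁ b₁ c₁ d₁) (mk≈ᴹ a₂ b₂ c₂ d₂) =
    mk≈ᴹ (≈-trans a₁ a₂) (≈-trans b₁ b₂) (≈-trans c₁ c₂) (≈-trans d₁ d₂)

  tr-cong : ∀ {M N} → M ≈ᴹ N → tr M ≈ tr N
  tr-cong {M} (mk≈ᴹ a≈ _ _ d≈) = +-cong {a M} a≈ d≈

  det-cong : ∀ {M N} → M ≈ᴹ N → det M ≈ det N
  det-cong {M} (mk≈ᴹ a≈ b≈ c≈ d≈) = –-cong {a M ℤ.* d M} (*-cong {a M} a≈ d≈) (*-cong {b M} b≈ c≈)

module Chains (k : ℕ) (prime : Prime (suc (suc k))) (n' d' : ℕ) where
  open Matrices k prime public

  -- δ is the paper's d; the name d is taken by a matrix entry.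
  n δ : ℕ
  n = suc n'
  δ = suc d'

  detPower : ℤ → Mat → Bool
  detPower E M = eqF ℓ (det M ℤ.^ n) E

  Ndet Ntr0 Ntreq : ℕ
  Ndet  = n * (2 * ℓ ^ 3)
  Ntr0  = n * (2 * ℓ ^ 2)
  Ntreq = n * ((δ + δ) * (2 * ℓ ^ 2))

  power-resp : ∀ E {u v} → u ≈ v → T (eqF ℓ (u ℤ.^ n) E) → T (eqF ℓ (v ℤ.^ n) E)
  power-resp E {u} {v} u≈v = eqF-resp {u ℤ.^ n} {v ℤ.^ n} {E} {E} (^-cong n u≈v) ≈-refl

  count-detPower-≤ : ∀ E → count (detPower E) GL ≤ Ndet
  count-detPower-≤ E = ℕ.≤-trans
    (count-by-value GL (λ e → eqF ℓ (e ℤ.^ n) E) (λ e M → eqF ℓ (det M) e) (2 * ℓ ^ 3)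
      (λ {u} {v} → power-resp E {u} {v}) (λ {u} {v} {M} u≈v → eqF-resp {det M} {det M} {u} {v} ≈-refl u≈v)
      (λ {M} _ t → det M , t , ≈⇒eqF {det M} {det M} ≈-refl) count-det-≤)
    (ℕ.*-monoˡ-≤ (2 * ℓ ^ 3) (power-roots-≤ n' E))

  count-detPower-tr≈0-≤ : ∀ E → count (λ M → detPower E M ∧ eqF ℓ (tr M) (+ 0)) GL ≤ Ntr0
  count-detPower-tr≈0-≤ E = ℕ.≤-trans
    (count-by-value GL (λ e → eqF ℓ (e ℤ.^ n) E) (λ e M → eqF ℓ (det M) e ∧ eqF ℓ (tr M) (+ 0)) (2 * ℓ ^ 2)
      (λ {u} {v} → power-resp E {u} {v})
      (λ {u} {v} {M} u≈v φ → ∧-intro {eqF ℓ (det M) v}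
        (eqF-resp {det M} {det M} {u} {v} ≈-refl u≈v (∧-elimˡ {eqF ℓ (det M) u} φ)) (∧-elimʳ {eqF ℓ (det M) u} φ))
      (λ {M} _ t → det M , ∧-elimˡ {detPower E M} t , ∧-intro {eqF ℓ (det M) (det M)} (≈⇒eqF {det M} {det M} ≈-refl) (∧-elimʳ {detPower E M} t))
      (λ e → count-det-tr-≤ e (+ 0)))
    (ℕ.*-monoˡ-≤ (2 * ℓ ^ 2) (power-roots-≤ n' E))

  traceEquation : ℤ → ℤ → Mat → Bool
  traceEquation P R M = eqF ℓ (P ℤ.* tr M ℤ.^ (δ + δ)) (R ℤ.* det M ℤ.^ δ)

  count-traceEquation-≤ : ∀ (good : ℤ → Bool) P R → P ≉ + 0 →
    (∀ {u v} → u ≈ v → T (good u) → T (good v)) →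
    count (λ M → good (det M) ∧ traceEquation P R M) GL ≤ count good F * ((δ + δ) * (2 * ℓ ^ 2))
  count-traceEquation-≤ good P R P≉0 good-resp =
    count-by-value GL good fibre ((δ + δ) * (2 * ℓ ^ 2)) good-resp
      (λ {u} {v} {M} u≈v φ → ∧-intro {eqF ℓ (det M) v}
        (eqF-resp {det M} {det M} {u} {v} ≈-refl u≈v (∧-elimˡ {eqF ℓ (det M) u} φ))
        (eqF-resp {P ℤ.* tr M ℤ.^ (δ + δ)} {P ℤ.* tr M ℤ.^ (δ + δ)} {R ℤ.* u ℤ.^ δ} {R ℤ.* v ℤ.^ δ}
          ≈-refl (*-congˡ {R} (^-cong δ u≈v)) (∧-elimʳ {eqF ℓ (det M) u} φ)))
      (λ {M} _ t → det M , ∧-elimˡ {good (det M)} t ,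
        ∧-intro {eqF ℓ (det M) (det M)} (≈⇒eqF {det M} {det M} ≈-refl) (∧-elimʳ {good (det M)} t))
      fibre-≤
    where
    fibre : ℤ → Mat → Bool
    fibre e M = eqF ℓ (det M) e ∧ eqF ℓ (P ℤ.* tr M ℤ.^ (δ + δ)) (R ℤ.* e ℤ.^ δ)
    fibre-≤ : ∀ e → count (fibre e) GL ≤ (δ + δ) * (2 * ℓ ^ 2)
    fibre-≤ e = ℕ.≤-trans
      (count-by-value GL (λ τ → eqF ℓ (P ℤ.* τ ℤ.^ (δ + δ)) (R ℤ.* e ℤ.^ δ))
        (λ τ M → eqF ℓ (det M) e ∧ eqF ℓ (tr M) τ) (2 * ℓ ^ 2)
        (λ {u} {v} u≈v → eqF-resp {P ℤ.* u ℤ.^ (δ + δ)} {P ℤ.* v ℤ.^ (δ + δ)} {R ℤ.* e ℤ.^ δ} {R ℤ.* e ℤ.^ δ}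
          (*-congˡ {P} (^-cong (δ + δ) u≈v)) ≈-refl)
        (λ {u} {v} {M} u≈v φ → ∧-intro {eqF ℓ (det M) e} (∧-elimˡ {eqF ℓ (det M) e} φ)
          (eqF-resp {tr M} {tr M} {u} {v} ≈-refl u≈v (∧-elimʳ {eqF ℓ (det M) e} φ)))
        (λ {M} _ φ → tr M , ∧-elimʳ {eqF ℓ (det M) e} φ ,
          ∧-intro {eqF ℓ (det M) e} (∧-elimˡ {eqF ℓ (det M) e} φ) (≈⇒eqF {tr M} {tr M} ≈-refl))
        (λ τ → count-det-tr-≤ e τ))
      (ℕ.*-monoˡ-≤ (2 * ℓ ^ 2) (binomial-roots-≤ (d' + δ) (R ℤ.* e ℤ.^ δ) P≉0))

  -- Chain E P R Ns: every N in Ns has det N ^ n ≈ E, and P · ∏ tr N ^ 2δ ≈ R · ∏ det N ^ δ,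
  -- the two products being accumulated into P and R.
  Chain : ℤ → ℤ → ℤ → List Mat → Bool
  Chain E P R []       = eqF ℓ P R
  Chain E P R (N ∷ Ns) = detPower E N ∧ Chain E (P ℤ.* tr N ℤ.^ (δ + δ)) (R ℤ.* det N ℤ.^ δ) Ns

  chains : ℤ → ℤ → ℤ → ℕ → ℕ
  chains E P R m = count (λ v → Chain E P R (Vec.toList v)) (allVecs GL m)

  chains-suc : ∀ E P R m → chains E P R (suc m) ≡
    ∑[ N ← GL ] (⟦ detPower E N ⟧ * chains E (P ℤ.* tr N ℤ.^ (δ + δ)) (R ℤ.* det N ℤ.^ δ) m)
  chains-suc E P R m = trans (∑-allVecs-suc GL m (λ v → ⟦ Chain E P R (Vec.toList v) ⟧))
    (∑-cong GL (λ {N} _ → count-∧ˡ (allVecs GL m) (detPower E N)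
      (λ v → Chain E (P ℤ.* tr N ℤ.^ (δ + δ)) (R ℤ.* det N ℤ.^ δ) (Vec.toList v))))

  Chain⇒detPower : ∀ E P R Ns → T (Chain E P R Ns) → T (all (detPower E) Ns)
  Chain⇒detPower E P R []       _ = tt
  Chain⇒detPower E P R (N ∷ Ns) t = ∧-intro {detPower E N} (∧-elimˡ {detPower E N} t)
    (Chain⇒detPower E _ _ Ns (∧-elimʳ {detPower E N} t))

  chains-≤-trivial : ∀ E P R m → chains E P R m ≤ Ndet ^ m
  chains-≤-trivial E P R m = ℕ.≤-trans
    (count-mono (allVecs GL m) {q = λ v → all (detPower E) (Vec.toList v)}
      (λ {v} _ → Chain⇒detPower E P R (Vec.toList v)))
    (ℕ.≤-trans (count-allVecs-all GL m (detPower E)) (ℕ.^-monoˡ-≤ m (count-detPower-≤ E)))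

  Degenerate : ℤ → ℤ → Set
  Degenerate P R = P ≈ + 0 × R ≈ + 0

  R*detᵟ≈0⇒R≈0 : ∀ {R N} → N ∈ GL → R ℤ.* det N ℤ.^ δ ≈ + 0 → R ≈ + 0
  R*detᵟ≈0⇒R≈0 {R} {N} N∈GL p =
    [ (λ R≈0 → R≈0) , (λ detᵟ≈0 → ⊥-elim (^-≉0 δ (GL-det≉0 N∈GL) detᵟ≈0)) ]′ (x*y≈0⇒x≈0⊎y≈0 R (det N ℤ.^ δ) p)

  degenerate-step : ∀ {P R N} → N ∈ GL → ¬ Degenerate P R →
    Degenerate (P ℤ.* tr N ℤ.^ (δ + δ)) (R ℤ.* det N ℤ.^ δ) → tr N ≈ + 0
  degenerate-step {P} {R} {N} N∈GL nondeg (P'≈0 , R'≈0) =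
    [ (λ P≈0 → ⊥-elim (nondeg (P≈0 , R*detᵟ≈0⇒R≈0 N∈GL R'≈0))) , x^n≈0⇒x≈0 (δ + δ) ]′
      (x*y≈0⇒x≈0⊎y≈0 P (tr N ℤ.^ (δ + δ)) P'≈0)

  chains-≤ : ∀ m E P R → ¬ Degenerate P R → chains E P R (suc m) ≤ Ndet ^ m * (Ntreq + m * Ntr0)
  chains-≤ zero E P R nondeg = begin
    chains E P R 1
      ≡⟨ trans (chains-suc E P R 0) (∑-cong GL (λ {N} _ → trans
           (cong (⟦ detPower E N ⟧ *_) (ℕ.+-identityʳ ⟦ traceEquation P R N ⟧))
           (sym (⟦∧⟧ (detPower E N) (traceEquation P R N))))) ⟩
    count (λ N → detPower E N ∧ traceEquation P R N) GL
      ≤⟨ single (P ≈? + 0) ⟩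
    Ntreq
      ≡⟨ arith Ntreq ⟩
    1 * (Ntreq + 0 * Ntr0) ∎
    where
    open ℕ.≤-Reasoning
    arith : ∀ x → x ≡ 1 * (x + 0 * Ntr0)
    arith x = sym (trans (ℕ.*-identityˡ _) (ℕ.+-identityʳ x))
    single : Dec (P ≈ + 0) → count (λ N → detPower E N ∧ traceEquation P R N) GL ≤ Ntreq
    single (no P≉0) = ℕ.≤-trans
      (count-traceEquation-≤ (λ e → eqF ℓ (e ℤ.^ n) E) P R P≉0 (λ {u} {v} → power-resp E {u} {v}))
      (ℕ.*-monoˡ-≤ _ (power-roots-≤ n' E))
    single (yes P≈0) = ℕ.≤-trans (ℕ.≤-reflexive (count-none _ GL none)) ℕ.z≤n
      where
      none : ∀ {N} → N ∈ GL → ¬ T (detPower E N ∧ traceEquation P R N)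
      none {N} N∈GL t = nondeg (P≈0 , R*detᵟ≈0⇒R≈0 N∈GL (≈-trans
        (≈-sym (eqF⇒≈ {P ℤ.* tr N ℤ.^ (δ + δ)} {R ℤ.* det N ℤ.^ δ} (∧-elimʳ {detPower E N} t)))
        (x≈0⇒x*y≈0 (tr N ℤ.^ (δ + δ)) P≈0)))
  chains-≤ (suc m) E P R nondeg = begin
    chains E P R (suc (suc m))
      ≡⟨ chains-suc E P R (suc m) ⟩
    ∑[ N ← GL ] (⟦ detPower E N ⟧ * chains E (P' N) (R' N) (suc m))
      ≤⟨ ∑-mono GL per-matrix ⟩
    ∑[ N ← GL ] (⟦ detPower E N ⟧ * X + ⟦ detPower E N ∧ eqF ℓ (tr N) (+ 0) ⟧ * Ndet ^ suc m)
      ≡⟨ ∑-+ GL _ _ ⟩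
    ∑[ N ← GL ] (⟦ detPower E N ⟧ * X) + ∑[ N ← GL ] (⟦ detPower E N ∧ eqF ℓ (tr N) (+ 0) ⟧ * Ndet ^ suc m)
      ≡⟨ cong₂ _+_ (∑-*ʳ GL X (λ N → ⟦ detPower E N ⟧))
                   (∑-*ʳ GL (Ndet ^ suc m) (λ N → ⟦ detPower E N ∧ eqF ℓ (tr N) (+ 0) ⟧)) ⟩
    count (detPower E) GL * X + count (λ N → detPower E N ∧ eqF ℓ (tr N) (+ 0)) GL * Ndet ^ suc m
      ≤⟨ ℕ.+-mono-≤ (ℕ.*-monoˡ-≤ X (count-detPower-≤ E)) (ℕ.*-monoˡ-≤ (Ndet ^ suc m) (count-detPower-tr≈0-≤ E)) ⟩
    Ndet * X + Ntr0 * Ndet ^ suc m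
      ≡⟨ arith Ndet (Ndet ^ m) Ntreq Ntr0 m ⟩
    Ndet ^ suc m * (Ntreq + suc m * Ntr0) ∎
    where
    open ℕ.≤-Reasoning
    P' R' : Mat → ℤ
    P' N = P ℤ.* tr N ℤ.^ (δ + δ)
    R' N = R ℤ.* det N ℤ.^ δ
    X = Ndet ^ m * (Ntreq + m * Ntr0)
    arith : ∀ b bᵐ t s m → b * (bᵐ * (t + m * s)) + s * (b * bᵐ) ≡ b * bᵐ * (t + suc m * s)
    arith = ℕ-Solver.solve-∀
    per-matrix : ∀ {N} → N ∈ GL → ⟦ detPower E N ⟧ * chains E (P' N) (R' N) (suc m)
                               ≤ ⟦ detPower E N ⟧ * X + ⟦ detPower E N ∧ eqF ℓ (tr N) (+ 0) ⟧ * Ndet ^ suc m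
    per-matrix {N} N∈GL = by-cases (P' N ≈? + 0) (R' N ≈? + 0)
      where
      nondegenerate-case : ¬ Degenerate (P' N) (R' N) → ⟦ detPower E N ⟧ * chains E (P' N) (R' N) (suc m)
                               ≤ ⟦ detPower E N ⟧ * X + ⟦ detPower E N ∧ eqF ℓ (tr N) (+ 0) ⟧ * Ndet ^ suc m
      nondegenerate-case nondeg' =
        ℕ.≤-trans (ℕ.*-monoʳ-≤ ⟦ detPower E N ⟧ (chains-≤ m E (P' N) (R' N) nondeg')) (ℕ.m≤m+n _ _)
      by-cases : Dec (P' N ≈ + 0) → Dec (R' N ≈ + 0) → ⟦ detPower E N ⟧ * chains E (P' N) (R' N) (suc m)
                               ≤ ⟦ detPower E N ⟧ * X + ⟦ detPower E N ∧ eqF ℓ (tr N) (+ 0) ⟧ * Ndet ^ suc m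
      by-cases (yes P'≈0) (yes R'≈0) = ℕ.≤-trans
        (ℕ.*-mono-≤ (⟦⟧-mono {detPower E N} (λ t → ∧-intro {detPower E N} t
           (≈⇒eqF {tr N} {+ 0} (degenerate-step N∈GL nondeg (P'≈0 , R'≈0)))))
          (chains-≤-trivial E (P' N) (R' N) (suc m)))
        (ℕ.m≤n+m _ _)
      by-cases (no P'≉0) _        = nondegenerate-case (λ (P'≈0 , _) → P'≉0 P'≈0)
      by-cases (yes _)   (no R'≉0) = nondegenerate-case (λ (_ , R'≈0) → R'≉0 R'≈0)

  -- The condition that membership in C imposes on the first column of a tuple.
  admissible : ℤ → List Mat → Bool
  admissible c₀ []       = true
  admissible c₀ (M ∷ Ms) = Chain (det M ℤ.^ n) (tr M ℤ.^ (δ + δ)) (c₀ ℤ.* det M ℤ.^ δ) Ms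

  admissibleBound : ℕ → ℕ
  admissibleBound zero    = ℓ * ((δ + δ) * (2 * ℓ ^ 2))
  admissibleBound (suc m) = ℓ ^ 4 * (Ndet ^ m * (Ntreq + m * Ntr0)) + ℓ ^ 3 * Ndet ^ suc m

  count-admissible-≤ : ∀ c₀ m →
    count (λ v → admissible c₀ (Vec.toList v)) (allVecs GL (suc m)) ≤ admissibleBound m
  count-admissible-≤ c₀ zero = begin
    count (λ v → admissible c₀ (Vec.toList v)) (allVecs GL 1)
      ≡⟨ ∑-allVecs-suc GL 0 (λ v → ⟦ admissible c₀ (Vec.toList v) ⟧) ⟩
    ∑[ M ← GL ] (⟦ equation M ⟧ + 0)
      ≤⟨ ∑-mono GL (λ {M} _ → ℕ.≤-trans (ℕ.≤-reflexive (ℕ.+-identityʳ ⟦ equation M ⟧)) (⟦⟧-mono (with-unit M))) ⟩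
    count (λ M → true ∧ traceEquation (+ 1) c₀ M) GL
      ≤⟨ count-traceEquation-≤ (λ _ → true) (+ 1) c₀ 1≉0 (λ _ _ → tt) ⟩
    count (λ _ → true) F * ((δ + δ) * (2 * ℓ ^ 2))
      ≤⟨ ℕ.*-monoˡ-≤ ((δ + δ) * (2 * ℓ ^ 2)) (count-F≤ℓ (λ _ → true)) ⟩
    ℓ * ((δ + δ) * (2 * ℓ ^ 2)) ∎
    where
    open ℕ.≤-Reasoning
    equation : Mat → Bool
    equation M = eqF ℓ (tr M ℤ.^ (δ + δ)) (c₀ ℤ.* det M ℤ.^ δ)
    with-unit : ∀ M → T (equation M) → T (traceEquation (+ 1) c₀ M)
    with-unit M = eqF-resp {tr M ℤ.^ (δ + δ)} {+ 1 ℤ.* tr M ℤ.^ (δ + δ)} {c₀ ℤ.* det M ℤ.^ δ} {c₀ ℤ.* det M ℤ.^ δ}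
      (≈-reflexive (sym (ℤ.*-identityˡ (tr M ℤ.^ (δ + δ))))) ≈-refl
  count-admissible-≤ c₀ (suc m) = begin
    count (λ v → admissible c₀ (Vec.toList v)) (allVecs GL (suc (suc m)))
      ≡⟨ ∑-allVecs-suc GL (suc m) (λ v → ⟦ admissible c₀ (Vec.toList v) ⟧) ⟩
    ∑[ M ← GL ] chains (det M ℤ.^ n) (tr M ℤ.^ (δ + δ)) (c₀ ℤ.* det M ℤ.^ δ) (suc m)
      ≤⟨ ∑-mono GL per-matrix ⟩
    ∑[ M ← GL ] (X + ⟦ eqF ℓ (tr M) (+ 0) ⟧ * Ndet ^ suc m)
      ≡⟨ ∑-+ GL _ _ ⟩
    ∑[ _ ← GL ] X + ∑[ M ← GL ] (⟦ eqF ℓ (tr M) (+ 0) ⟧ * Ndet ^ suc m)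
      ≡⟨ cong₂ _+_ (∑-const GL X) (∑-*ʳ GL (Ndet ^ suc m) (λ M → ⟦ eqF ℓ (tr M) (+ 0) ⟧)) ⟩
    length GL * X + count (λ M → eqF ℓ (tr M) (+ 0)) GL * Ndet ^ suc m
      ≤⟨ ℕ.+-mono-≤ (ℕ.*-monoˡ-≤ X length-GL-≤) (ℕ.*-monoˡ-≤ (Ndet ^ suc m) (count-tr-≤ (+ 0))) ⟩
    ℓ ^ 4 * X + ℓ ^ 3 * Ndet ^ suc m ∎
    where
    open ℕ.≤-Reasoning
    X = Ndet ^ m * (Ntreq + m * Ntr0)
    per-matrix : ∀ {M} → M ∈ GL → chains (det M ℤ.^ n) (tr M ℤ.^ (δ + δ)) (c₀ ℤ.* det M ℤ.^ δ) (suc m)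
                               ≤ X + ⟦ eqF ℓ (tr M) (+ 0) ⟧ * Ndet ^ suc m
    per-matrix {M} _ = by-cases (P ≈? + 0) (R ≈? + 0)
      where
      P = tr M ℤ.^ (δ + δ)
      R = c₀ ℤ.* det M ℤ.^ δ
      nondegenerate-case : ¬ Degenerate P R → chains (det M ℤ.^ n) P R (suc m) ≤ X + ⟦ eqF ℓ (tr M) (+ 0) ⟧ * Ndet ^ suc m
      nondegenerate-case nondeg = ℕ.≤-trans (chains-≤ m (det M ℤ.^ n) P R nondeg) (ℕ.m≤m+n X _)
      by-cases : Dec (P ≈ + 0) → Dec (R ≈ + 0) → chains (det M ℤ.^ n) P R (suc m) ≤ X + ⟦ eqF ℓ (tr M) (+ 0) ⟧ * Ndet ^ suc m
      by-cases (yes P≈0) (yes _) = ℕ.≤-trans (chains-≤-trivial (det M ℤ.^ n) P R (suc m))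
        (ℕ.≤-trans (ℕ.≤-reflexive (sym (trans (cong (_* Ndet ^ suc m)
          (⟦⟧-true (≈⇒eqF {tr M} {+ 0} (x^n≈0⇒x≈0 (δ + δ) P≈0)))) (ℕ.*-identityˡ _)))) (ℕ.m≤n+m _ X))
      by-cases (no P≉0) _        = nondegenerate-case (λ (P≈0 , _) → P≉0 P≈0)
      by-cases (yes _)  (no R≉0) = nondegenerate-case (λ (_ , R≈0) → R≉0 R≈0)

prodZ-++ : ∀ (f : Mat → ℤ) xs ys → prodZ (map f (xs ++ ys)) ≡ prodZ (map f xs) ℤ.* prodZ (map f ys)
prodZ-++ f []       ys = sym (ℤ.*-identityˡ _)
prodZ-++ f (x ∷ xs) ys = trans (cong (f x ℤ.*_) (prodZ-++ f xs ys)) (sym (ℤ.*-assoc (f x) _ _))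

prodZ-^-+ : ∀ (f : Mat → ℤ) m xs →
  prodZ (map (λ N → f N ℤ.^ (m + m)) xs) ≡ prodZ (map (λ N → f N ℤ.^ m) xs) ℤ.* prodZ (map (λ N → f N ℤ.^ m) xs)
prodZ-^-+ f m []       = refl
prodZ-^-+ f m (x ∷ xs) = trans (cong₂ ℤ._*_ (ℤ.^-distribˡ-+-* (f x) m m) (prodZ-^-+ f m xs))
  (interchange (f x ℤ.^ m) (prodZ (map (λ N → f N ℤ.^ m) xs)))
  where
  interchange : ∀ a b → (a ℤ.* a) ℤ.* (b ℤ.* b) ≡ (a ℤ.* b) ℤ.* (a ℤ.* b)
  interchange = solve-∀

tr-scale : ∀ z M → tr (scale z M) ≡ z ℤ.* tr M
tr-scale z M = distrib z (a M) (d M)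
  where
  distrib : ∀ z a d → z ℤ.* a ℤ.+ z ℤ.* d ≡ z ℤ.* (a ℤ.+ d)
  distrib = solve-∀

det-scale : ∀ z M → det (scale z M) ≡ (z ℤ.* z) ℤ.* det M
det-scale z M = distrib z (a M) (b M) (c M) (d M)
  where
  distrib : ∀ z a b c d → z ℤ.* a ℤ.* (z ℤ.* d) ℤ.- z ℤ.* b ℤ.* (z ℤ.* c) ≡ (z ℤ.* z) ℤ.* (a ℤ.* d ℤ.- b ℤ.* c)
  distrib = solve-∀

module Tuples (k : ℕ) (prime : Prime (suc (suc k))) (n' d' : ℕ) where
  open Chains k prime n' d' public

  μ-≉0 : ∀ {ζ} → T (inMu ℓ n ζ) → ζ ≉ + 0
  μ-≉0 {ζ} t ζ≈0 = 1≉0 (≈-trans (≈-sym (eqF⇒≈ {ζ ℤ.^ n} {+ 1} t)) (x≈0⇒x*y≈0 (ζ ℤ.^ n') ζ≈0))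

  scalarMultiple⇒ : ∀ M N → T (scalarMultiple n M N) →
    ∃ λ ζ → ζ ≉ + 0 × tr N ≈ ζ ℤ.* tr M × det N ≈ (ζ ℤ.* ζ) ℤ.* det M
  scalarMultiple⇒ M N t with find (any⁻ (λ ζ → inMu ℓ n ζ ∧ eqMat ℓ N (scale ζ M)) F t)
  ... | ζ , _ , u = ζ , μ-≉0 (∧-elimˡ {inMu ℓ n ζ} u) ,
    ≈-trans (tr-cong (eqMat⇒≈ᴹ {N} {scale ζ M} N≡ζM)) (≈-reflexive (tr-scale ζ M)) ,
    ≈-trans (det-cong (eqMat⇒≈ᴹ {N} {scale ζ M} N≡ζM)) (≈-reflexive (det-scale ζ M))
    where
    N≡ζM = ∧-elimʳ {inMu ℓ n ζ} u

  row-factor : ∀ M Ns → All (λ N → T (scalarMultiple n M N)) Ns → ∃ λ Z → Z ≉ + 0 ×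
    prodZ (map tr Ns) ≈ Z ℤ.* tr M ℤ.^ length Ns × prodZ (map det Ns) ≈ (Z ℤ.* Z) ℤ.* det M ℤ.^ length Ns
  row-factor M []       []       = + 1 , 1≉0 , ≈-refl , ≈-refl
  row-factor M (N ∷ Ns) (t ∷ ts) =
    let ζ , ζ≉0 , trN , detN = scalarMultiple⇒ M N t
        Z , Z≉0 , trNs , detNs = row-factor M Ns ts
    in ζ ℤ.* Z , *-≉0 ζ≉0 Z≉0 ,
    ≈-trans (*-cong trN trNs) (≈-reflexive (regroup ζ Z (tr M) (tr M ℤ.^ length Ns))) ,
    ≈-trans (*-cong detN detNs) (≈-reflexive (regroup² ζ Z (det M) (det M ℤ.^ length Ns)))
    where
    regroup : ∀ z w t u → (z ℤ.* t) ℤ.* (w ℤ.* u) ≡ (z ℤ.* w) ℤ.* (t ℤ.* u)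
    regroup = solve-∀
    regroup² : ∀ z w t u → ((z ℤ.* z) ℤ.* t) ℤ.* ((w ℤ.* w) ℤ.* u) ≡ ((z ℤ.* w) ℤ.* (z ℤ.* w)) ℤ.* (t ℤ.* u)
    regroup² = solve-∀

  rowsOK : ∀ {g} → Tuple g δ → Bool
  rowsOK X = Vec.foldr _ (λ row acc → rowCondB ℓ n row ∧ acc) true X

  tuple-factor : ∀ {g} (X : Tuple g δ) → T (rowsOK X) → ∃ λ W → W ≉ + 0 ×
    prodZ (map tr (entries X)) ≈ W ℤ.* prodZ (map (λ M → tr M ℤ.^ δ) (firsts X)) ×
    prodZ (map det (entries X)) ≈ (W ℤ.* W) ℤ.* prodZ (map (λ M → det M ℤ.^ δ) (firsts X))
  tuple-factor []              _ = + 1 , 1≉0 , ≈-refl , ≈-refl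
  tuple-factor ((M ∷ ms) ∷ X) t =
    let Z , Z≉0 , trRow , detRow =
          row-factor M row (all⁺ (scalarMultiple n M) row (∧-elimˡ {rowCondB ℓ n (M ∷ ms)} t))
        W , W≉0 , trX , detX = tuple-factor X (∧-elimʳ {rowCondB ℓ n (M ∷ ms)} t)
    in Z ℤ.* W , *-≉0 Z≉0 W≉0 ,
    ≈-trans (≈-reflexive (prodZ-++ tr row (entries X)))
      (≈-trans (*-cong (≈-trans trRow (≈-reflexive (cong (λ j → Z ℤ.* tr M ℤ.^ j) len))) trX)
        (≈-reflexive (regroup Z W (tr M ℤ.^ δ) _))) ,
    ≈-trans (≈-reflexive (prodZ-++ det row (entries X)))
      (≈-trans (*-cong (≈-trans detRow (≈-reflexive (cong (λ j → (Z ℤ.* Z) ℤ.* det M ℤ.^ j) len))) detX)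
        (≈-reflexive (regroup² Z W (det M ℤ.^ δ) _)))
    where
    row = M ∷ Vec.toList ms
    len : length row ≡ δ
    len = cong suc (length-toList ms)
    regroup : ∀ z w t u → (z ℤ.* t) ℤ.* (w ℤ.* u) ≡ (z ℤ.* w) ℤ.* (t ℤ.* u)
    regroup = solve-∀
    regroup² : ∀ z w t u → ((z ℤ.* z) ℤ.* t) ℤ.* ((w ℤ.* w) ℤ.* u) ≡ ((z ℤ.* w) ℤ.* (z ℤ.* w)) ℤ.* (t ℤ.* u)
    regroup² = solve-∀

  Chain-intro : ∀ E P R Ns → T (all (detPower E) Ns) →
    P ℤ.* prodZ (map (λ N → tr N ℤ.^ (δ + δ)) Ns) ≈ R ℤ.* prodZ (map (λ N → det N ℤ.^ δ) Ns) →
    T (Chain E P R Ns)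
  Chain-intro E P R []       _ eq = ≈⇒eqF {P} {R}
    (≈-trans (≈-reflexive (sym (ℤ.*-identityʳ P))) (≈-trans eq (≈-reflexive (ℤ.*-identityʳ R))))
  Chain-intro E P R (N ∷ Ns) t eq = ∧-intro {detPower E N} (∧-elimˡ {detPower E N} t)
    (Chain-intro E (P ℤ.* tr N ℤ.^ (δ + δ)) (R ℤ.* det N ℤ.^ δ) Ns (∧-elimʳ {detPower E N} t)
      (≈-trans (≈-reflexive (ℤ.*-assoc P (tr N ℤ.^ (δ + δ)) _))
        (≈-trans eq (≈-reflexive (sym (ℤ.*-assoc R (det N ℤ.^ δ) _))))))

  inC⇒admissible : ∀ c₀ {g} (X : Tuple (suc g) δ) → T (inC ℓ n c₀ X) → T (rowsOK X ∧ admissible c₀ (firsts X))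
  inC⇒admissible c₀ X@((M ∷ ms) ∷ X') t =
    let W , W≉0 , trX , detX = tuple-factor X rows-ok
    in ∧-intro {rowsOK X} rows-ok (Chain-intro (det M ℤ.^ n) (tr M ℤ.^ (δ + δ)) (c₀ ℤ.* det M ℤ.^ δ) Fs
      same-detPower (first-equation W W≉0 trX detX))
    where
    open ≈-Reasoning
    Fs = firsts X'
    inB-X = ∧-elimˡ {inB ℓ n X} t
    rows-ok = ∧-elimˡ {rowsOK X} inB-X
    same-detPower : T (all (detPower (det M ℤ.^ n)) Fs)
    same-detPower = all⁻ (detPower (det M ℤ.^ n)) (All.map
      (λ {N} u → ≈⇒eqF {det N ℤ.^ n} {det M ℤ.^ n} (≈-sym (eqF⇒≈ {det M ℤ.^ n} {det N ℤ.^ n} u)))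
      (all⁺ _ Fs (∧-elimʳ {eqF ℓ (det M ℤ.^ n) (det M ℤ.^ n)}
        (∧-elimˡ {all (λ N → eqF ℓ (det M ℤ.^ n) (det N ℤ.^ n)) (M ∷ Fs)} (∧-elimʳ {rowsOK X} inB-X)))))
    trᵟ detᵟ trᵟᵟ : ℤ
    trᵟ  = prodZ (map (λ N → tr N ℤ.^ δ) Fs)
    detᵟ = prodZ (map (λ N → det N ℤ.^ δ) Fs)
    trᵟᵟ = prodZ (map (λ N → tr N ℤ.^ (δ + δ)) Fs)
    first-equation : ∀ W → W ≉ + 0 →
      prodZ (map tr (entries X)) ≈ W ℤ.* (tr M ℤ.^ δ ℤ.* trᵟ) →
      prodZ (map det (entries X)) ≈ (W ℤ.* W) ℤ.* (det M ℤ.^ δ ℤ.* detᵟ) →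
      tr M ℤ.^ (δ + δ) ℤ.* trᵟᵟ ≈ (c₀ ℤ.* det M ℤ.^ δ) ℤ.* detᵟ
    first-equation W W≉0 trX detX = begin
      tr M ℤ.^ (δ + δ) ℤ.* trᵟᵟ
        ≡⟨ cong₂ ℤ._*_ (ℤ.^-distribˡ-+-* (tr M) δ δ) (prodZ-^-+ tr δ Fs) ⟩
      (tr M ℤ.^ δ ℤ.* tr M ℤ.^ δ) ℤ.* (trᵟ ℤ.* trᵟ)
        ≈⟨ *-cancelˡ-≈ (*-≉0 W≉0 W≉0) (begin
             (W ℤ.* W) ℤ.* ((tr M ℤ.^ δ ℤ.* tr M ℤ.^ δ) ℤ.* (trᵟ ℤ.* trᵟ))
               ≡⟨ square W (tr M ℤ.^ δ) trᵟ ⟩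
             (W ℤ.* (tr M ℤ.^ δ ℤ.* trᵟ)) ℤ.^ 2
               ≈⟨ ^-cong 2 (≈-sym trX) ⟩
             prodZ (map tr (entries X)) ℤ.^ 2
               ≈⟨ eqF⇒≈ {prodZ (map tr (entries X)) ℤ.^ 2} {c₀ ℤ.* prodZ (map det (entries X))}
                    (∧-elimʳ {inB ℓ n X} t) ⟩
             c₀ ℤ.* prodZ (map det (entries X))
               ≈⟨ *-congˡ {c₀} detX ⟩
             c₀ ℤ.* ((W ℤ.* W) ℤ.* (det M ℤ.^ δ ℤ.* detᵟ))
               ≡⟨ ℤ.*-comm c₀ _ ⟩
             ((W ℤ.* W) ℤ.* (det M ℤ.^ δ ℤ.* detᵟ)) ℤ.* c₀
               ≡⟨ ℤ.*-assoc (W ℤ.* W) _ c₀ ⟩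
             (W ℤ.* W) ℤ.* ((det M ℤ.^ δ ℤ.* detᵟ) ℤ.* c₀) ∎) ⟩
      (det M ℤ.^ δ ℤ.* detᵟ) ℤ.* c₀
        ≡⟨ rotate (det M ℤ.^ δ) detᵟ c₀ ⟩
      (c₀ ℤ.* det M ℤ.^ δ) ℤ.* detᵟ ∎
      where
      square : ∀ w x y → (w ℤ.* w) ℤ.* ((x ℤ.* x) ℤ.* (y ℤ.* y)) ≡ (w ℤ.* (x ℤ.* y)) ℤ.* ((w ℤ.* (x ℤ.* y)) ℤ.* + 1)
      square = solve-∀
      rotate : ∀ x y c → (x ℤ.* y) ℤ.* c ≡ (c ℤ.* x) ℤ.* y
      rotate = solve-∀

  count-rowCondB-≤ : ∀ M → count (λ ms → rowCondB ℓ n (M ∷ ms)) (allVecs GL d') ≤ n ^ d'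
  count-rowCondB-≤ M = ℕ.≤-trans
    (count-mono (allVecs GL d') {q = λ ms → all (scalarMultiple n M) (Vec.toList ms)}
      (λ _ → ∧-elimʳ {scalarMultiple n M M}))
    (ℕ.≤-trans (count-allVecs-all GL d' (scalarMultiple n M)) (ℕ.^-monoˡ-≤ d' (count-scalarMultiple-≤ n' M)))

  count-rowsOK-≤ : ∀ g (q : List Mat → Bool) →
    count (λ X → rowsOK X ∧ q (firsts X)) (allVecs (allVecs GL δ) g)
      ≤ (n ^ d') ^ g * count (λ v → q (Vec.toList v)) (allVecs GL g)
  count-rowsOK-≤ zero    q = ℕ.≤-reflexive (sym (ℕ.*-identityˡ _))
  count-rowsOK-≤ (suc g) q = begin
    count (λ X → rowsOK X ∧ q (firsts X)) (allVecs (allVecs GL δ) (suc g))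
      ≡⟨ ∑-allVecs-suc (allVecs GL δ) g _ ⟩
    ∑[ row ← allVecs GL δ ] count (λ X → rowsOK (row ∷ X) ∧ q (firsts (row ∷ X))) (allVecs (allVecs GL δ) g)
      ≡⟨ ∑-allVecs-suc GL d' _ ⟩
    ∑[ M ← GL ] ∑[ ms ← allVecs GL d' ] count (λ X → (rowCondB ℓ n (M ∷ ms) ∧ rowsOK X) ∧ q (M ∷ firsts X))
                                               (allVecs (allVecs GL δ) g)
      ≤⟨ ∑-mono GL (λ {M} _ → ∑-mono (allVecs GL d') (λ {ms} _ → per-row M ms)) ⟩
    ∑[ M ← GL ] ∑[ ms ← allVecs GL d' ] (⟦ rowCondB ℓ n (M ∷ ms) ⟧ * (K ^ g * rest M))
      ≡⟨ ∑-cong GL (λ {M} _ → ∑-*ʳ (allVecs GL d') (K ^ g * rest M) (λ ms → ⟦ rowCondB ℓ n (M ∷ ms) ⟧)) ⟩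
    ∑[ M ← GL ] (count (λ ms → rowCondB ℓ n (M ∷ ms)) (allVecs GL d') * (K ^ g * rest M))
      ≤⟨ ∑-mono GL (λ {M} _ → ℕ.*-monoˡ-≤ (K ^ g * rest M) (count-rowCondB-≤ M)) ⟩
    ∑[ M ← GL ] (K * (K ^ g * rest M))
      ≡⟨ trans (∑-*ˡ GL K _) (cong (K *_) (∑-*ˡ GL (K ^ g) rest)) ⟩
    K * (K ^ g * ∑ GL rest)
      ≡⟨ sym (ℕ.*-assoc K (K ^ g) _) ⟩
    K ^ suc g * ∑ GL rest
      ≡⟨ cong (K ^ suc g *_) (sym (∑-allVecs-suc GL g (λ v → ⟦ q (Vec.toList v) ⟧))) ⟩
    K ^ suc g * count (λ v → q (Vec.toList v)) (allVecs GL (suc g)) ∎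
    where
    open ℕ.≤-Reasoning
    K = n ^ d'
    rest : Mat → ℕ
    rest M = count (λ v → q (M ∷ Vec.toList v)) (allVecs GL g)
    per-row : ∀ M ms →
      count (λ X → (rowCondB ℓ n (M ∷ ms) ∧ rowsOK X) ∧ q (M ∷ firsts X)) (allVecs (allVecs GL δ) g)
        ≤ ⟦ rowCondB ℓ n (M ∷ ms) ⟧ * (K ^ g * rest M)
    per-row M ms = begin
      count (λ X → (rowCondB ℓ n (M ∷ ms) ∧ rowsOK X) ∧ q (M ∷ firsts X)) (allVecs (allVecs GL δ) g)
        ≡⟨ ∑-cong (allVecs (allVecs GL δ) g) (λ {X} _ →
             cong ⟦_⟧ (∧-assoc (rowCondB ℓ n (M ∷ ms)) (rowsOK X) (q (M ∷ firsts X)))) ⟩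
      count (λ X → rowCondB ℓ n (M ∷ ms) ∧ (rowsOK X ∧ q (M ∷ firsts X))) (allVecs (allVecs GL δ) g)
        ≡⟨ count-∧ˡ (allVecs (allVecs GL δ) g) (rowCondB ℓ n (M ∷ ms)) _ ⟩
      ⟦ rowCondB ℓ n (M ∷ ms) ⟧ * count (λ X → rowsOK X ∧ q (M ∷ firsts X)) (allVecs (allVecs GL δ) g)
        ≤⟨ ℕ.*-monoʳ-≤ ⟦ rowCondB ℓ n (M ∷ ms) ⟧ (count-rowsOK-≤ g (λ Ms → q (M ∷ Ms))) ⟩
      ⟦ rowCondB ℓ n (M ∷ ms) ⟧ * (K ^ g * rest M) ∎

  cardC-≤ : ∀ m c₀ → cardC ℓ (suc m) δ n c₀ ≤ (n ^ d') ^ suc m * admissibleBound m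
  cardC-≤ m c₀ = begin
    cardC ℓ (suc m) δ n c₀
      ≡⟨ length-filterᵇ (inC ℓ n c₀) (allTuples ℓ (suc m) δ) ⟩
    count (inC ℓ n c₀) (allVecs (allVecs GL δ) (suc m))
      ≤⟨ count-mono (allVecs (allVecs GL δ) (suc m)) (λ {X} _ → inC⇒admissible c₀ X) ⟩
    count (λ X → rowsOK X ∧ admissible c₀ (firsts X)) (allVecs (allVecs GL δ) (suc m))
      ≤⟨ count-rowsOK-≤ (suc m) (admissible c₀) ⟩
    (n ^ d') ^ suc m * count (λ v → admissible c₀ (Vec.toList v)) (allVecs GL (suc m))
      ≤⟨ ℕ.*-monoʳ-≤ ((n ^ d') ^ suc m) (count-admissible-≤ c₀ m) ⟩
    (n ^ d') ^ suc m * admissibleBound m ∎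
    where open ℕ.≤-Reasoning

module ConstantTuples (k : ℕ) (prime : Prime (suc (suc k))) (d' : ℕ) where
  open Matrices k prime

  constantRow : ℤ → Vec Mat (suc d') → Bool
  constantRow e (M ∷ ms) = eqF ℓ (det M) e ∧ all (eqMat ℓ M) (Vec.toList ms)

  constantRows : ℤ → ∀ {g} → Tuple g (suc d') → Bool
  constantRows e []        = true
  constantRows e (row ∷ X) = constantRow e row ∧ constantRows e X

  count-constantRow-≥ : ∀ e → count (λ M → eqF ℓ (det M) e) GL ≤ count (constantRow e) (allVecs GL (suc d'))
  count-constantRow-≥ e = ℕ.≤-trans (∑-mono GL per-matrix)
    (ℕ.≤-reflexive (sym (∑-allVecs-suc GL d' (λ row → ⟦ constantRow e row ⟧))))
    where
    replicate-∈ : ∀ {M} → M ∈ GL → Vec.replicate d' M ∈ allVecs GL d'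
    replicate-∈ {M} M∈GL = allVecs-∈ GL (Vec.replicate d' M)
      (subst (All (_∈ GL)) (sym (toList-replicate d' M)) (replicate⁺ d' M∈GL))
    replicate-constant : ∀ M → T (all (eqMat ℓ M) (Vec.toList (Vec.replicate d' M)))
    replicate-constant M = all⁻ (eqMat ℓ M)
      (subst (All (λ N → T (eqMat ℓ M N))) (sym (toList-replicate d' M)) (replicate⁺ d' (≈ᴹ⇒eqMat {M} ≈ᴹ-refl)))
    per-matrix : ∀ {M} → M ∈ GL → ⟦ eqF ℓ (det M) e ⟧ ≤ count (λ ms → constantRow e (M ∷ ms)) (allVecs GL d')
    per-matrix {M} M∈GL = begin
      ⟦ eqF ℓ (det M) e ⟧
        ≡⟨ ℕ.*-identityʳ _ ⟨
      ⟦ eqF ℓ (det M) e ⟧ * 1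
        ≤⟨ ℕ.*-monoʳ-≤ ⟦ eqF ℓ (det M) e ⟧
             (count-member (λ ms → all (eqMat ℓ M) (Vec.toList ms)) (replicate-∈ M∈GL) (replicate-constant M)) ⟩
      ⟦ eqF ℓ (det M) e ⟧ * count (λ ms → all (eqMat ℓ M) (Vec.toList ms)) (allVecs GL d')
        ≡⟨ count-∧ˡ (allVecs GL d') (eqF ℓ (det M) e) _ ⟨
      count (λ ms → constantRow e (M ∷ ms)) (allVecs GL d') ∎
      where open ℕ.≤-Reasoning

  count-constantRows-≥ : ∀ e g →
    count (λ M → eqF ℓ (det M) e) GL ^ g ≤ count (constantRows e) (allVecs (allVecs GL (suc d')) g)
  count-constantRows-≥ e zero    = ℕ.≤-refl
  count-constantRows-≥ e (suc g) = begin
    count (λ M → eqF ℓ (det M) e) GL * count (λ M → eqF ℓ (det M) e) GL ^ g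
      ≤⟨ ℕ.*-mono-≤ (count-constantRow-≥ e) (count-constantRows-≥ e g) ⟩
    count (constantRow e) rows * count (constantRows e) (allVecs rows g)
      ≡⟨ ∑-*ʳ rows _ (λ row → ⟦ constantRow e row ⟧) ⟨
    ∑[ row ← rows ] (⟦ constantRow e row ⟧ * count (constantRows e) (allVecs rows g))
      ≡⟨ ∑-cong rows (λ {row} _ → count-∧ˡ (allVecs rows g) (constantRow e row) (constantRows e)) ⟨
    ∑[ row ← rows ] count (λ X → constantRows e (row ∷ X)) (allVecs rows g)
      ≡⟨ ∑-allVecs-suc rows g (λ X → ⟦ constantRows e X ⟧) ⟨
    count (constantRows e) (allVecs rows (suc g)) ∎
    where
    open ℕ.≤-Reasoning
    rows = allVecs GL (suc d')

  constantRow⇒≈ᴹ : ∀ {e M ms} → T (constantRow e (M ∷ ms)) → ∀ {N} → N ∈ M ∷ Vec.toList ms → M ≈ᴹ N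
  constantRow⇒≈ᴹ                    _ (here refl) = ≈ᴹ-refl
  constantRow⇒≈ᴹ {e} {M} {ms} t (there N∈ms) =
    eqMat⇒≈ᴹ (All.lookup (all⁺ (eqMat ℓ M) (Vec.toList ms) (∧-elimʳ {eqF ℓ (det M) e} t)) N∈ms)

  constantRows⇒det≈ : ∀ {e g} (X : Tuple g (suc d')) → T (constantRows e X) → ∀ {N} → N ∈ entries X → det N ≈ e
  constantRows⇒det≈ {e} ((M ∷ ms) ∷ X) t N∈ =
    [ (λ N∈row → ≈-trans (≈-sym (det-cong (constantRow⇒≈ᴹ {e} {M} {ms} row-const N∈row)))
                         (eqF⇒≈ {det M} {e} (∧-elimˡ {eqF ℓ (det M) e} row-const)))
    , constantRows⇒det≈ X (∧-elimʳ {constantRow e (M ∷ ms)} t) ]′ (∈-++⁻ (M ∷ Vec.toList ms) N∈)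
    where
    row-const = ∧-elimˡ {constantRow e (M ∷ ms)} t

  constantRows⇒pairwise : ∀ {e g} (X : Tuple g (suc d')) → T (constantRows e X) →
    T (Vec.foldr _ (λ row acc → all (λ M → all (λ N → eqMat ℓ M N) (Vec.toList row)) (Vec.toList row) ∧ acc) true X)
  constantRows⇒pairwise []              _ = tt
  constantRows⇒pairwise {e} ((M ∷ ms) ∷ X) t =
    ∧-intro {all (λ N → all (λ N' → eqMat ℓ N N') row) row}
      (all⁻ _ (All.tabulate λ N∈ → all⁻ _ (All.tabulate λ N'∈ →
        ≈ᴹ⇒eqMat (≈ᴹ-trans (≈ᴹ-sym (constantRow⇒≈ᴹ {e} {M} {ms} row-const N∈)) (constantRow⇒≈ᴹ {e} {M} {ms} row-const N'∈)))))
      (constantRows⇒pairwise X (∧-elimʳ {constantRow e (M ∷ ms)} t))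
    where
    row = M ∷ Vec.toList ms
    row-const = ∧-elimˡ {constantRow e (M ∷ ms)} t

  constantRows⇒inA : ∀ {e g} (X : Tuple g (suc d')) → T (constantRows e X) → T (inA ℓ X)
  constantRows⇒inA {e} X t = ∧-intro {Vec.foldr _ _ true X} (constantRows⇒pairwise X t)
    (all⁻ _ (All.tabulate λ {N} N∈ → all⁻ _ (All.tabulate λ {N'} N'∈ →
      ≈⇒eqF {det N} {det N'} (≈-trans (constantRows⇒det≈ X t N∈) (≈-sym (constantRows⇒det≈ X t N'∈))))))

  cardA-≥ : ∀ m → suc k * (suc k * ℓ ^ 2) ^ suc m ≤ cardA ℓ (suc m) (suc d')
  cardA-≥ m = begin
    suc k * (suc k * ℓ ^ 2) ^ suc m
      ≤⟨ ∑-F-≥-nonzero _ (λ {e} _ e≉0 →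
           ℕ.≤-trans (ℕ.^-monoˡ-≤ (suc m) (count-det-≥ e e≉0)) (count-constantRows-≥ e (suc m))) ⟩
    ∑[ e ← F ] count (constantRows e) tuples
      ≡⟨ ∑-comm F tuples (λ e X → ⟦ constantRows e X ⟧) ⟩
    ∑[ X ← tuples ] count (λ e → constantRows e X) F
      ≤⟨ ∑-mono tuples (λ {X} _ → at-most-one-class X) ⟩
    count (inA ℓ) tuples
      ≡⟨ length-filterᵇ (inA ℓ) tuples ⟨
    cardA ℓ (suc m) (suc d') ∎
    where
    open ℕ.≤-Reasoning
    tuples = allVecs (allVecs GL (suc d')) (suc m)
    at-most-one-class : ∀ X → count (λ e → constantRows e X) F ≤ ⟦ inA ℓ X ⟧
    at-most-one-class X@((M ∷ ms) ∷ _) = count-≤-⟦⟧ (λ e → constantRows e X) F (inA ℓ X)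
      (count-F≤1 (λ e → constantRows e X) (λ {e} {e'} t t' →
        ≈-trans (≈-sym (det≈ e t)) (det≈ e' t')))
      (λ {e} _ → constantRows⇒inA X)
      where
      det≈ : ∀ e → T (constantRows e X) → det M ≈ e
      det≈ e t = eqF⇒≈ {det M} {e} (∧-elimˡ {eqF ℓ (det M) e} (∧-elimˡ {constantRow e (M ∷ ms)} t))

^-distribʳ-* : ∀ a b m → (a * b) ^ m ≡ a ^ m * b ^ m
^-distribʳ-* a b zero    = refl
^-distribʳ-* a b (suc m) = trans (cong ((a * b) *_) (^-distribʳ-* a b m)) (interchange a b (a ^ m) (b ^ m))
  where
  interchange : ∀ a b x y → (a * b) * (x * y) ≡ (a * x) * (b * y)
  interchange = ℕ-Solver.solve-∀

κ : ℕ → ℕ → ℕ → ℕ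
κ n δ m = (2 * n) ^ m * (2 * (δ + δ + m))

constant : ℕ → ℕ → ℕ → ℕ
constant m n' d' = (suc n' ^ d') ^ suc m * κ (suc n') (suc d') m * 2 ^ suc (suc m)

module Final (k : ℕ) (prime : Prime (suc (suc k))) (n' d' : ℕ) where
  open Tuples k prime n' d'
  open ConstantTuples k prime d' using (cardA-≥)

  admissibleBound-≤ : ∀ m → admissibleBound m ≤ κ n δ m * (ℓ ^ 3) ^ suc m
  admissibleBound-≤ zero    = ℕ.≤-reflexive (exact ℓ (δ + δ))
    where
    exact : ∀ l D → l * (D * (2 * (l * (l * 1)))) ≡ 1 * (2 * (D + 0)) * (l * (l * (l * 1)) * 1)
    exact = ℕ-Solver.solve-∀
  admissibleBound-≤ (suc m) = begin
    ℓ ^ 4 * (Ndet ^ m * (Ntreq + m * Ntr0)) + ℓ ^ 3 * (Ndet * Ndet ^ m)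
      ≡⟨ cong (λ x → ℓ ^ 4 * (x * (Ntreq + m * Ntr0)) + ℓ ^ 3 * (Ndet * x)) Ndetᵐ ⟩
    X
      ≤⟨ ℕ.m≤m+n X X ⟩
    X + X
      ≡⟨ double ℓ n (δ + δ) m ((2 * n) ^ m) ((ℓ ^ 3) ^ m) ⟩
    κ n δ (suc m) * (ℓ ^ 3) ^ suc (suc m) ∎
    where
    open ℕ.≤-Reasoning
    Ndetᵐ : Ndet ^ m ≡ (2 * n) ^ m * (ℓ ^ 3) ^ m
    Ndetᵐ = trans (cong (_^ m) (regroup n (ℓ ^ 3))) (^-distribʳ-* (2 * n) (ℓ ^ 3) m)
      where
      regroup : ∀ n x → n * (2 * x) ≡ 2 * n * x
      regroup = ℕ-Solver.solve-∀
    X = ℓ ^ 4 * ((2 * n) ^ m * (ℓ ^ 3) ^ m * (Ntreq + m * Ntr0)) + ℓ ^ 3 * (Ndet * ((2 * n) ^ m * (ℓ ^ 3) ^ m))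
    double : ∀ l n D m P Q →
      let l² = l * (l * 1); l³ = l * l²; l⁴ = l * l³
          x  = l⁴ * (P * Q * (n * (D * (2 * l²)) + m * (n * (2 * l²)))) + l³ * (n * (2 * l³) * (P * Q))
      in x + x ≡ 2 * n * P * (2 * (D + suc m)) * (l³ * (l³ * Q))
    double = ℕ-Solver.solve-∀

  ℓ≤2[ℓ-1] : ℓ ≤ 2 * suc k
  ℓ≤2[ℓ-1] = ℕ.≤-trans (ℕ.+-monoˡ-≤ (suc k) (s≤s z≤n)) (ℕ.≤-reflexive (cong (_+_ (suc k)) (sym (ℕ.+-identityʳ (suc k)))))

  ℓ*[ℓ^3]^g-≤ : ∀ g → ℓ * (ℓ ^ 3) ^ g ≤ 2 ^ suc g * (suc k * (suc k * ℓ ^ 2) ^ g)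
  ℓ*[ℓ^3]^g-≤ g = begin
    ℓ * (ℓ * ℓ ^ 2) ^ g
      ≤⟨ ℕ.*-mono-≤ ℓ≤2[ℓ-1] (ℕ.^-monoˡ-≤ g (ℕ.*-monoˡ-≤ (ℓ ^ 2) ℓ≤2[ℓ-1])) ⟩
    2 * suc k * (2 * suc k * ℓ ^ 2) ^ g
      ≡⟨ cong (λ x → 2 * suc k * x) (trans (cong (_^ g) (ℕ.*-assoc 2 (suc k) (ℓ ^ 2)))
           (^-distribʳ-* 2 (suc k * ℓ ^ 2) g)) ⟩
    2 * suc k * (2 ^ g * (suc k * ℓ ^ 2) ^ g)
      ≡⟨ regroup (suc k) (2 ^ g) ((suc k * ℓ ^ 2) ^ g) ⟩
    2 ^ suc g * (suc k * (suc k * ℓ ^ 2) ^ g) ∎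
    where
    open ℕ.≤-Reasoning
    regroup : ∀ s t x → 2 * s * (t * x) ≡ 2 * t * (s * x)
    regroup = ℕ-Solver.solve-∀

  ℓ*cardC≤constant*cardA : ∀ m c₀ → ℓ * cardC ℓ (suc m) δ n c₀ ≤ constant m n' d' * cardA ℓ (suc m) δ
  ℓ*cardC≤constant*cardA m c₀ = begin
    ℓ * cardC ℓ (suc m) δ n c₀
      ≤⟨ ℕ.*-monoʳ-≤ ℓ (ℕ.≤-trans (cardC-≤ m c₀) (ℕ.*-monoʳ-≤ (K ^ suc m) (admissibleBound-≤ m))) ⟩
    ℓ * (K ^ suc m * (κ n δ m * (ℓ ^ 3) ^ suc m))
      ≡⟨ regroup ℓ (K ^ suc m) (κ n δ m) ((ℓ ^ 3) ^ suc m) ⟩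
    K ^ suc m * κ n δ m * (ℓ * (ℓ ^ 3) ^ suc m)
      ≤⟨ ℕ.*-monoʳ-≤ (K ^ suc m * κ n δ m) (ℓ*[ℓ^3]^g-≤ (suc m)) ⟩
    K ^ suc m * κ n δ m * (2 ^ suc (suc m) * (suc k * (suc k * ℓ ^ 2) ^ suc m))
      ≡⟨ ℕ.*-assoc (K ^ suc m * κ n δ m) _ _ ⟨
    constant m n' d' * (suc k * (suc k * ℓ ^ 2) ^ suc m)
      ≤⟨ ℕ.*-monoʳ-≤ (constant m n' d') (cardA-≥ m) ⟩
    constant m n' d' * cardA ℓ (suc m) δ ∎
    where
    open ℕ.≤-Reasoning
    K = n ^ d'
    regroup : ∀ l K κ x → l * (K * (κ * x)) ≡ K * κ * (l * x)
    regroup = ℕ-Solver.solve-∀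

constant>0 : ∀ m n' d' → constant m n' d' > 0
constant>0 m n' d' = ℕ.*-mono-≤ (ℕ.*-mono-≤ (ℕ.m^n>0 (suc n' ^ d') {{ℕ.>-nonZero (ℕ.m^n>0 (suc n') d')}} (suc m))
  (ℕ.*-mono-≤ (ℕ.m^n>0 (2 * suc n') m) (s≤s z≤n))) (ℕ.m^n>0 2 (suc (suc m)))

lemma5p6 : (g' d n : ℕ) → g' > 0 → d > 0 → n > 0 →
    ∃[ C ] (C > 0 × ((c₀ : ℤ) → ∃[ L ] ((ℓ : ℕ) → Prime ℓ → ℓ ≥ L →
    ℓ * cardC ℓ g' d n c₀ ≤ C * cardA ℓ g' d)))
lemma5p6 (suc m) (suc d') (suc n') _ _ _ = constant m n' d' , constant>0 m n' d' , λ c₀ → 0 , every-prime c₀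
  where
  every-prime : ∀ c₀ ℓ → Prime ℓ → ℓ ≥ 0 →
    ℓ * cardC ℓ (suc m) (suc d') (suc n') c₀ ≤ constant m n' d' * cardA ℓ (suc m) (suc d')
  every-prime c₀ 0             p _ = ⊥-elim (¬prime[0] p)
  every-prime c₀ 1             p _ = ⊥-elim (¬prime[1] p)
  every-prime c₀ (suc (suc k)) p _ = Final.ℓ*cardC≤constant*cardA k p n' d' m c₀
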